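{- If a one-tape Turing machine $M$ runs in time $T(n)$ for some function $T$ with $T(n)=o(n\log n)$, then there exists a constant $D$ such that, on every input $w$, $M$ visits at most $|w|+D$ tape cells.
   Context: $\log$ is base $2$; $T(n)=o(n\log n)$ means $\lim_{n\to\infty}T(n)/(n\log n)=0$. $|w|$ is the length of $w$. Turing machines are deterministic. A one-tape Turing machine has a single both-way infinite read-write tape which also holds the input, and its head moves (left or right) at every step. A Turing machine $M$ runs in time $T(n)$ if for every $n$, $M$ makes at most $T(n)$ steps on every input of length $n$. -}

module Defs where

open import Data.Nat using (ℕ; zero; suc; _+_; _*_; _≤_)
open import Data.Nat.Logarithm using (⌊log₂_⌋)
open import Data.Integer as ℤ using (ℤ; +_; -[1+_])
open import Data.Fin using (Fin)
open import Data.Sum using (_⊎_; inj₁; inj₂)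
open import Data.Maybe using (Maybe; just; nothing)
open import Data.Product using (_×_; _,_; Σ; ∃)
open import Data.List using (List; []; _∷_; length; deduplicate)
open import Relation.Binary.PropositionalEquality using (_≡_)
open import Relation.Nullary using (yes; no)

data Move : Set where
  L R : Move

-- The machine halts exactly when δ is undefined (returns nothing).
record TM : Set where
  field
    nQ nΣ nΓ : ℕ
    q₀       : Fin nQ
  Sym : Set
  Sym = Maybe (Fin nΣ ⊎ Fin nΓ)   -- nothing = blank
  field
    δ : Fin nQ → Sym → Maybe (Fin nQ × Sym × Move)

module _ (M : TM) where
  open TM M

  record Config : Set where
    constructor ⟨_,_,_⟩
    field
      state : Fin nQ
      tape  : ℤ → Sym
      pos   : ℤ
  open Config public

  nth : {A : Set} → List A → ℕ → Maybe A
  nth []       _       = nothing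
  nth (x ∷ xs) zero    = just x
  nth (x ∷ xs) (suc k) = nth xs k

  initTape : List (Fin nΣ) → ℤ → Sym
  initTape w (+ k)    with nth w k
  ... | just a  = just (inj₁ a)
  ... | nothing = nothing
  initTape w -[1+ k ] = nothing

  initConfig : List (Fin nΣ) → Config
  initConfig w = ⟨ q₀ , initTape w , + 0 ⟩

  write : (ℤ → Sym) → ℤ → Sym → ℤ → Sym
  write t i a j with j ℤ.≟ i
  ... | yes _ = a
  ... | no  _ = t j

  moveHead : Move → ℤ → ℤ
  moveHead L i = i ℤ.- + 1
  moveHead R i = i ℤ.+ + 1

  step : Config → Maybe Config
  step ⟨ q , t , i ⟩ with δ q (t i)
  ... | nothing            = nothing
  ... | just (q' , a , m)  = just ⟨ q' , write t i a , moveHead m i ⟩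

  run : ℕ → Config → Maybe Config
  run zero    c = just c
  run (suc k) c with step c
  ... | nothing = nothing
  ... | just c' = run k c'

  HaltsAfter : List (Fin nΣ) → ℕ → Set
  HaltsAfter w k = Σ Config λ c → (run k (initConfig w) ≡ just c) × (step c ≡ nothing)

  RunsInTime : (ℕ → ℕ) → Set
  RunsInTime T = ∀ (w : List (Fin nΣ)) → ∃ λ k → (k ≤ T (length w)) × HaltsAfter w k

  trace : ℕ → Config → List ℤ
  trace zero    c = pos c ∷ []
  trace (suc t) c with step c
  ... | nothing = pos c ∷ []
  ... | just c' = pos c ∷ trace t c'

  visitedCells : List (Fin nΣ) → ℕ → ℕ
  visitedCells w t = length (deduplicate ℤ._≟_ (trace t (initConfig w)))

-- T(n) = o(n log n): for every k, eventually k · T(n) ≤ n · ⌊log₂ n⌋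
LittleONLogN : (ℕ → ℕ) → Set
LittleONLogN T = ∀ (k : ℕ) → ∃ λ N → ∀ n → N ≤ n → k * T n ≤ n * ⌊log₂ n ⌋

module Submission where

-- Hennie's crossing-sequence argument. Let w be a shortest input on which the head reaches a cell at
-- or beyond |w| + A. If two boundaries inside w carried the same crossing sequence, cutting out the
-- tape between them would leave a shorter such input; if two boundaries in the blank region beyond w
-- did, the same cut would leave the input, hence the run, unchanged, yet move its rightmost cell to
-- the left. So each of the two blocks of boundaries carries pairwise distinct crossing sequences.
-- At most (1 + |Q|)^ℓ of these are shorter than ℓ, and each step crosses one boundary, so the run
-- takes at least ℓ (|w| − (1 + |Q|)^ℓ) + ℓ (A − (1 + |Q|)^ℓ) steps. Since T(n) = o(n log n),
-- choosing ℓ ≈ log n / 2(1 + |Q|) for large n, and A large enough for the finitely many small n,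
-- makes this exceed T(|w|). The left end is symmetric, so every run stays inside (−A, |w| + A).

open import Defs
open import Data.Nat using (ℕ; suc)

module Integers where

  open import Data.Integer
  open import Data.Integer.Properties
  open import Data.Integer.Tactic.RingSolver using (solve-∀)
  open import Data.List using (List)
  open import Data.List.Membership.Propositional using (_∈_)
  open import Data.List.Relation.Unary.All using (tabulate)
  open import Data.List.Extrema ≤-totalOrder using (max; min; argmax-all; argmin-all)
  open import Relation.Binary.PropositionalEquality

  i-j+j≡i : ∀ i j → i - j + j ≡ i
  i-j+j≡i = solve-∀

  j+[i-j]≡i : ∀ i j → j + (i - j) ≡ i
  j+[i-j]≡i = solve-∀

  i+j+k≡i+k+j : ∀ i j k → i + j + k ≡ i + k + j
  i+j+k≡i+k+j = solve-∀

  +-cancelʳ-≡ : ∀ {i j} k → i + k ≡ j + k → i ≡ j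
  +-cancelʳ-≡ {i} {j} k eq = trans (i≡i+k-k i k) (trans (cong (_- k) eq) (sym (i≡i+k-k j k)))
    where
      i≡i+k-k : ∀ i k → i ≡ i + k - k
      i≡i+k-k = solve-∀

  i<i+1 : ∀ i → i < i + + 1
  i<i+1 i = subst (i <_) (+-comm (+ 1) i) (suc[i]≤j⇒i<j ≤-refl)

  i-1<i : ∀ i → i - + 1 < i
  i-1<i i = subst (i - + 1 <_) (i-j+j≡i i (+ 1)) (i<i+1 (i - + 1))

  i<j⇒i+1≤j : ∀ {i j} → i < j → i + + 1 ≤ j
  i<j⇒i+1≤j {i} i<j = subst (_≤ _) (+-comm (+ 1) i) (i<j⇒suc[i]≤j i<j)

  i<j+1⇒i≤j : ∀ {i j} → i < j + + 1 → i ≤ j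
  i<j+1⇒i≤j {i} {j} i<j+1 = subst (i ≤_) (pred[j+1]≡j j) (i<j⇒i≤pred[j] i<j+1)
    where
      pred[j+1]≡j : ∀ j → -1ℤ + (j + + 1) ≡ j
      pred[j+1]≡j = solve-∀

  i<j⇒i-j<0 : ∀ {i j} → i < j → i - j < + 0
  i<j⇒i-j<0 {i} {j} i<j = subst (i - j <_) (+-inverseʳ j) (+-monoˡ-< (- j) i<j)

  i<j⇒0<j-i : ∀ {i j} → i < j → + 0 < j - i
  i<j⇒0<j-i {i} {j} i<j = subst (_< j - i) (+-inverseʳ i) (+-monoˡ-< (- i) i<j)

  i+k<i : ∀ i {k} → k < + 0 → i + k < i
  i+k<i i k<0 = subst (i + _ <_) (+-identityʳ i) (+-monoʳ-< i k<0)

  i<i+k : ∀ i {k} → + 0 < k → i < i + k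
  i<i+k i 0<k = subst (_< i + _) (+-identityʳ i) (+-monoʳ-< i 0<k)

  max-∈ : ∀ {x} {xs : List ℤ} → x ∈ xs → max x xs ∈ xs
  max-∈ {x} {xs} x∈xs = argmax-all (λ y → y) {P = _∈ xs} x∈xs (tabulate (λ y∈xs → y∈xs))

  min-∈ : ∀ {x} {xs : List ℤ} → x ∈ xs → min x xs ∈ xs
  min-∈ {x} {xs} x∈xs = argmin-all (λ y → y) {P = _∈ xs} x∈xs (tabulate (λ y∈xs → y∈xs))

module Lists where

  open import Data.Nat
  open import Data.Nat.Properties
  open import Data.Nat.Induction using (<-rec)
  open import Data.Nat.DivMod using ([m+kn]%n≡m%n; m<n⇒m%n≡m)
  open import Data.Nat.ListAction using (sum)
  open import Data.Bool using (true; false)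
  open import Data.Fin using (Fin; toℕ)
  import Data.Fin.Properties as Fin
  open import Data.Sum using (inj₁; inj₂)
  open import Data.Product using (_,_; proj₂)
  open import Data.List using (List; []; _∷_; _++_; length; map; filter; applyUpTo)
  open import Data.List.Properties using (length-map; length-upTo; filter-accept; filter-reject)
  open import Data.List.Membership.Propositional using (_∈_)
  open import Data.List.Membership.Propositional.Properties
    using (∈-∃++; ∈-++⁻; ∈-++⁺ˡ; ∈-++⁺ʳ; ∈-upTo⁺; ∈-filter⁻)
  open import Data.List.Relation.Unary.Any using (here; there)
  open import Data.List.Relation.Unary.All as All using (All; []; _∷_)
  import Data.List.Relation.Unary.All.Properties as All
  open import Data.List.Relation.Binary.Subset.Propositional using (_⊆_)
  open import Data.List.Relation.Binary.Permutation.Propositional.Properties using (↭-length; shift)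
  open import Data.List.Relation.Unary.Unique.Propositional using (Unique; []; _∷_)
  import Data.List.Relation.Unary.Unique.Propositional.Properties as Unique
  open import Relation.Nullary using (does; yes; no; contradiction)
  open import Relation.Unary using (Decidable)
  open import Relation.Unary.Properties using (∁?)
  open import Relation.Binary.PropositionalEquality
  open import Level using (Level)
  open import Relation.Binary.Definitions using (DecidableEquality)
  open import Data.Nat.Tactic.RingSolver using (solve-∀)

  private
    variable
      a p : Level
      A : Set a

  Unique-⊆⇒length≤ : {xs ys : List A} → Unique xs → xs ⊆ ys → length xs ≤ length ys
  Unique-⊆⇒length≤ [] _ = z≤n
  Unique-⊆⇒length≤ {xs = x ∷ xs} (x∉xs ∷ u) xs⊆ys
    with ys₁ , ys₂ , refl ← ∈-∃++ (xs⊆ys (here refl)) =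
    ≤-trans (s≤s (Unique-⊆⇒length≤ u xs⊆ys₁++ys₂)) (≤-reflexive (sym (↭-length (shift x ys₁ ys₂))))
    where
      xs⊆ys₁++ys₂ : xs ⊆ ys₁ ++ ys₂
      xs⊆ys₁++ys₂ y∈xs with ∈-++⁻ ys₁ (xs⊆ys (there y∈xs))
      ... | inj₁ y∈ys₁          = ∈-++⁺ˡ y∈ys₁
      ... | inj₂ (here refl)    = contradiction refl (All.lookup x∉xs y∈xs)
      ... | inj₂ (there y∈ys₂)  = ∈-++⁺ʳ ys₁ y∈ys₂

  Unique-All<⇒length≤ : ∀ {N} {ns : List ℕ} → Unique ns → All (_< N) ns → length ns ≤ N
  Unique-All<⇒length≤ {N} u ns<N =
    ≤-trans (Unique-⊆⇒length≤ u (λ n∈ns → ∈-upTo⁺ (All.lookup ns<N n∈ns))) (≤-reflexive (length-upTo N))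

  module _ {P : A → Set p} (P? : Decidable P) where

    length-filter+filter-∁ : ∀ xs → length (filter P? xs) + length (filter (∁? P?) xs) ≡ length xs
    length-filter+filter-∁ [] = refl
    length-filter+filter-∁ (x ∷ xs) with does (P? x)
    ... | true  = cong suc (length-filter+filter-∁ xs)
    ... | false = trans (+-suc _ _) (cong suc (length-filter+filter-∁ xs))

  *-length-filter≤sum : ∀ ℓ (f : A → ℕ) xs → ℓ * length (filter (λ x → ℓ ≤? f x) xs) ≤ sum (map f xs)
  *-length-filter≤sum ℓ f [] = ≤-reflexive (*-zeroʳ ℓ)
  *-length-filter≤sum ℓ f (x ∷ xs) with ℓ ≤? f x
  ... | yes ℓ≤fx = subst (λ ys → ℓ * length ys ≤ f x + sum (map f xs)) (sym (filter-accept long? ℓ≤fx))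
    (≤-trans (≤-reflexive (*-suc ℓ _)) (+-mono-≤ ℓ≤fx (*-length-filter≤sum ℓ f xs)))
    where long? = λ x → ℓ ≤? f x
  ... | no  ℓ≰fx = subst (λ ys → ℓ * length ys ≤ f x + sum (map f xs)) (sym (filter-reject long? ℓ≰fx))
    (≤-trans (*-length-filter≤sum ℓ f xs) (m≤n+m _ (f x)))
    where long? = λ x → ℓ ≤? f x

  -- Words over Fin s as base-(1 + s) numerals with nonzero digits, least significant first.
  module Numeral (s : ℕ) where

    base : ℕ
    base = suc s

    digit : Fin s → ℕ
    digit a = suc (toℕ a)

    numeral : List (Fin s) → ℕ
    numeral []       = 0
    numeral (a ∷ w)  = digit a + numeral w * base

    digit<base : ∀ a → digit a < base
    digit<base a = s≤s (Fin.toℕ<n a)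

    numeral-injective : ∀ v w → numeral v ≡ numeral w → v ≡ w
    numeral-injective []      []      _  = refl
    numeral-injective (a ∷ v) (b ∷ w) eq = cong₂ _∷_ a≡b (numeral-injective v w v≡w)
      where
        digits : digit a ≡ digit b
        digits = begin
          digit a                              ≡⟨ m<n⇒m%n≡m (digit<base a) ⟨
          digit a % base                       ≡⟨ [m+kn]%n≡m%n (digit a) (numeral v) base ⟨
          (digit a + numeral v * base) % base  ≡⟨ cong (_% base) eq ⟩
          (digit b + numeral w * base) % base  ≡⟨ [m+kn]%n≡m%n (digit b) (numeral w) base ⟩
          digit b % base                       ≡⟨ m<n⇒m%n≡m (digit<base b) ⟩
          digit b                              ∎
          where open ≡-Reasoning
        a≡b : a ≡ b
        a≡b = Fin.toℕ-injective (suc-injective digits)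
        v≡w : numeral v ≡ numeral w
        v≡w = *-cancelʳ-≡ _ _ base (+-cancelˡ-≡ _ _ _ (trans eq (cong (_+ numeral w * base) (sym digits))))

    numeral< : ∀ w → numeral w < base ^ length w
    numeral< []      = s≤s z≤n
    numeral< (a ∷ w) = begin-strict
      digit a + numeral w * base   <⟨ +-monoˡ-< (numeral w * base) (digit<base a) ⟩
      base + numeral w * base      ≡⟨ *-comm (suc (numeral w)) base ⟩
      base * suc (numeral w)       ≤⟨ *-monoʳ-≤ base (numeral< w) ⟩
      base * base ^ length w       ∎
      where open ≤-Reasoning

  module _ {s : ℕ} where
    open Numeral s

    length-short-words≤ : ∀ ℓ {ws : List (List (Fin s))} → Unique ws → All (λ w → length w < ℓ) ws →
                          length ws ≤ base ^ ℓ
    length-short-words≤ ℓ {ws} u short = begin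
      length ws                ≡⟨ length-map numeral ws ⟨
      length (map numeral ws)  ≤⟨ Unique-All<⇒length≤ (Unique.map⁺ (numeral-injective _ _) u) numerals< ⟩
      base ^ ℓ                 ∎
      where
        open ≤-Reasoning
        numerals< : All (_< base ^ ℓ) (map numeral ws)
        numerals< = All.map⁺ (All.map (λ {w} |w|<ℓ →
          <-≤-trans (numeral< w) (^-monoʳ-≤ base (<⇒≤ |w|<ℓ))) short)

    total-length-of-distinct-words : ∀ ℓ {ws : List (List (Fin s))} → Unique ws →
                                     ℓ * (length ws ∸ base ^ ℓ) ≤ sum (map length ws)
    total-length-of-distinct-words ℓ {ws} u = begin
      ℓ * (length ws ∸ base ^ ℓ)     ≤⟨ *-monoʳ-≤ ℓ (m≤n+o⇒m∸n≤o (length ws) (base ^ ℓ) ws≤short+long) ⟩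
      ℓ * length long                ≤⟨ *-length-filter≤sum ℓ length ws ⟩
      sum (map length ws)            ∎
      where
        open ≤-Reasoning
        long? = λ (w : List (Fin s)) → ℓ ≤? length w
        long  = filter long? ws
        short = filter (∁? long?) ws
        short≤ : length short ≤ base ^ ℓ
        short≤ = length-short-words≤ ℓ (Unique.filter⁺ (∁? long?) {ws} u)
          (All.tabulate (λ w∈ → ≰⇒> (proj₂ (∈-filter⁻ (∁? long?) {xs = ws} w∈))))
        ws≤short+long : length ws ≤ base ^ ℓ + length long
        ws≤short+long = begin
          length ws                    ≡⟨ length-filter+filter-∁ long? ws ⟨
          length long + length short   ≡⟨ +-comm (length long) (length short) ⟩
          length short + length long   ≤⟨ +-monoˡ-≤ (length long) short≤ ⟩
          base ^ ℓ + length long       ∎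

  ∈⇒≤sum : ∀ {n ns} → n ∈ ns → n ≤ sum ns
  ∈⇒≤sum {ns = m ∷ ms} (here refl) = m≤m+n m (sum ms)
  ∈⇒≤sum {ns = m ∷ ms} (there n∈ms) = ≤-trans (∈⇒≤sum n∈ms) (m≤n+m (sum ms) m)

  sum-map-+ : ∀ (f g : A → ℕ) xs → sum (map (λ x → f x + g x) xs) ≡ sum (map f xs) + sum (map g xs)
  sum-map-+ f g []       = refl
  sum-map-+ f g (x ∷ xs) = trans (cong (f x + g x +_) (sum-map-+ f g xs)) (interchange (f x) (g x) _ _)
    where
      interchange : ∀ a b c d → a + b + (c + d) ≡ a + c + (b + d)
      interchange = solve-∀

  sum-map-zero : ∀ {f : A → ℕ} {xs} → All (λ x → f x ≡ 0) xs → sum (map f xs) ≡ 0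
  sum-map-zero []           = refl
  sum-map-zero (fx≡0 ∷ all) = cong₂ _+_ fx≡0 (sum-map-zero all)

  sum-map-supported : ∀ (_≟_ : DecidableEquality A) {v} {f : A → ℕ} {xs} → Unique xs →
                      (∀ x → x ≢ v → f x ≡ 0) → sum (map f xs) ≤ f v
  sum-map-supported _≟_ [] _ = z≤n
  sum-map-supported _≟_ {v} {f} {x ∷ xs} (x∉xs ∷ u) f-vanishes with x ≟ v
  ... | no x≢v   = subst (λ n → n + sum (map f xs) ≤ f v) (sym (f-vanishes x x≢v))
                         (sum-map-supported _≟_ u f-vanishes)
  ... | yes refl = ≤-reflexive (trans (cong (f x +_) rest≡0) (+-identityʳ (f x)))
    where
      rest≡0 : sum (map f xs) ≡ 0
      rest≡0 = sum-map-zero (All.map (λ x≢y → f-vanishes _ (≢-sym x≢y)) x∉xs)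

  applyUpTo-+ : ∀ (f : ℕ → A) m n → applyUpTo f (m + n) ≡ applyUpTo f m ++ applyUpTo (λ i → f (m + i)) n
  applyUpTo-+ f zero    n = refl
  applyUpTo-+ f (suc m) n = cong (f 0 ∷_) (applyUpTo-+ (λ i → f (suc i)) m n)

  length-rec : (P : List A → Set p) → (∀ xs → (∀ {ys} → length ys < length xs → P ys) → P xs) →
               ∀ xs → P xs
  length-rec P step xs = <-rec (λ n → ∀ xs → length xs ≡ n → P xs)
    (λ n rec xs |xs|≡n → step xs (λ {ys} |ys|<|xs| → rec (subst (length ys <_) |xs|≡n |ys|<|xs|) ys refl))
    (length xs) xs refl

module Growth where

  open import Data.Nat
  open import Data.Nat.Properties
  open import Data.Nat.Logarithm
  open import Data.Nat.DivMod using (m/n*n≤m; m≡m%n+[m/n]*n; m%n<n)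
  open import Data.Nat.ListAction using (sum)
  open import Data.Nat.Induction using (<-rec)
  open import Data.Nat.Tactic.RingSolver using (solve-∀)
  open Lists using (∈⇒≤sum)
  open import Data.Product using (∃; _×_; _,_; proj₁; proj₂)
  open import Data.List using (map; upTo)
  open import Data.List.Membership.Propositional.Properties using (∈-map⁺; ∈-upTo⁺)
  open import Relation.Nullary using (yes; no; contradiction)
  open import Relation.Binary.PropositionalEquality

  n≤2^n : ∀ n → n ≤ 2 ^ n
  n≤2^n zero    = z≤n
  n≤2^n (suc n) = begin
    suc n          ≤⟨ s≤s (n≤2^n n) ⟩
    suc (2 ^ n)    ≤⟨ +-monoˡ-≤ (2 ^ n) (m^n>0 2 n) ⟩
    2 ^ n + 2 ^ n  ≡⟨ cong (2 ^ n +_) (+-identityʳ (2 ^ n)) ⟨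
    2 ^ suc n      ∎
    where open ≤-Reasoning

  2^⌊log₂n⌋≤n : ∀ n .{{_ : NonZero n}} → 2 ^ ⌊log₂ n ⌋ ≤ n
  2^⌊log₂n⌋≤n = <-rec (λ n → .{{_ : NonZero n}} → 2 ^ ⌊log₂ n ⌋ ≤ n) bound
    where
      bound : ∀ n → (∀ {m} → m < n → .{{_ : NonZero m}} → 2 ^ ⌊log₂ m ⌋ ≤ m) →
              .{{_ : NonZero n}} → 2 ^ ⌊log₂ n ⌋ ≤ n
      bound 1             _   = ≤-refl
      bound n@(suc (suc m)) rec = begin
        2 ^ ⌊log₂ n ⌋                  ≡⟨ cong (2 ^_) (m+[n∸m]≡n {1} {⌊log₂ n ⌋} 1≤lg) ⟨
        2 ^ (1 + (⌊log₂ n ⌋ ∸ 1))      ≡⟨ cong (λ k → 2 ^ suc k) (⌊log₂⌊n/2⌋⌋≡⌊log₂n⌋∸1 n) ⟨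
        2 * 2 ^ ⌊log₂ ⌊ n /2⌋ ⌋        ≤⟨ *-monoʳ-≤ 2 (rec (s≤s (s≤s (⌊n/2⌋≤n m)))) ⟩
        2 * ⌊ n /2⌋                    ≤⟨ 2*⌊n/2⌋≤n ⟩
        n                              ∎
        where
          open ≤-Reasoning
          1≤lg : 1 ≤ ⌊log₂ n ⌋
          1≤lg = ⌊log₂⌋-mono-≤ {2} {n} (s≤s (s≤s z≤n))
          2*⌊n/2⌋≤n : 2 * ⌊ n /2⌋ ≤ n
          2*⌊n/2⌋≤n = begin
            ⌊ n /2⌋ + (⌊ n /2⌋ + 0)  ≡⟨ cong (⌊ n /2⌋ +_) (+-identityʳ ⌊ n /2⌋) ⟩
            ⌊ n /2⌋ + ⌊ n /2⌋        ≤⟨ +-monoʳ-≤ ⌊ n /2⌋ (⌊n/2⌋≤⌈n/2⌉ n) ⟩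
            ⌊ n /2⌋ + ⌈ n /2⌉        ≡⟨ ⌊n/2⌋+⌈n/2⌉≡n n ⟩
            n                        ∎

  m<[1+m/n]*n : ∀ m n .{{_ : NonZero n}} → m < suc (m / n) * n
  m<[1+m/n]*n m n = begin-strict
    m                  ≡⟨ m≡m%n+[m/n]*n m n ⟩
    m % n + m / n * n  <⟨ +-monoˡ-< (m / n * n) (m%n<n m n) ⟩
    n + m / n * n      ∎
    where open ≤-Reasoning

  2*m≤n⇒n≤2*[n∸m] : ∀ {m n} → 2 * m ≤ n → n ≤ 2 * (n ∸ m)
  2*m≤n⇒n≤2*[n∸m] {m} {n} 2m≤n = begin
    n                        ≡⟨ m+[n∸m]≡n m≤n ⟨
    m + (n ∸ m)              ≤⟨ +-monoˡ-≤ (n ∸ m) m≤n∸m ⟩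
    (n ∸ m) + (n ∸ m)        ≡⟨ cong ((n ∸ m) +_) (+-identityʳ (n ∸ m)) ⟨
    2 * (n ∸ m)              ∎
    where
      open ≤-Reasoning
      m≤n : m ≤ n
      m≤n = ≤-trans (m≤m+n m (m + 0)) 2m≤n
      m≤n∸m : m ≤ n ∸ m
      m≤n∸m = m+n≤o⇒m≤o∸n m (subst (_≤ n) (cong (m +_) (+-identityʳ m)) 2m≤n)

  -- With ℓ := ⌊log₂ n⌋ / 2S we get S^ℓ ≤ 2^{Sℓ} ≤ √n, while ℓ is still of order log n / S.
  module _ (S : ℕ) .{{_ : NonZero S}} where

    log-block : ∀ n → 2 ^ (4 * S) ≤ n → ∃ λ ℓ → 2 * S ^ ℓ ≤ n × suc ⌊log₂ n ⌋ ≤ 4 * S * ℓ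
    log-block n 2^4S≤n = ℓ , 2S^ℓ≤n , 1+lg≤4Sℓ
      where
        instance
          2S≢0 : NonZero (2 * S)
          2S≢0 = m*n≢0 2 S
        lg = ⌊log₂ n ⌋
        ℓ = lg / (2 * S)
        4S≤lg : 4 * S ≤ lg
        4S≤lg = subst (_≤ lg) (⌊log₂[2^n]⌋≡n (4 * S)) (⌊log₂⌋-mono-≤ 2^4S≤n)
        ℓ*2S≤lg : ℓ * (2 * S) ≤ lg
        ℓ*2S≤lg = m/n*n≤m lg (2 * S)
        lg<[1+ℓ]*2S : lg < suc ℓ * (2 * S)
        lg<[1+ℓ]*2S = m<[1+m/n]*n lg (2 * S)
        1≤ℓ : 1 ≤ ℓ
        1≤ℓ with ℓ | lg<[1+ℓ]*2S
        ... | zero  | lg<2S = contradiction (≤-trans (*-monoˡ-≤ S {2} {4} (s≤s (s≤s z≤n))) 4S≤lg)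
                                           (<⇒≱ (subst (lg <_) (+-identityʳ (2 * S)) lg<2S))
        ... | suc _ | _    = s≤s z≤n
        1+lg≤4Sℓ : suc lg ≤ 4 * S * ℓ
        1+lg≤4Sℓ = +-cancelʳ-≤ (4 * S) (suc lg) (4 * S * ℓ) (begin
          suc lg + 4 * S                     ≤⟨ +-monoʳ-≤ (suc lg) (m≤n⇒m≤1+n 4S≤lg) ⟩
          suc lg + suc lg                    ≤⟨ +-mono-≤ lg<[1+ℓ]*2S lg<[1+ℓ]*2S ⟩
          suc ℓ * (2 * S) + suc ℓ * (2 * S)  ≡⟨ double S ℓ ⟩
          4 * S * ℓ + 4 * S                  ∎)
          where
            open ≤-Reasoning
            double : ∀ S ℓ → suc ℓ * (2 * S) + suc ℓ * (2 * S) ≡ 4 * S * ℓ + 4 * S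
            double = solve-∀
        2S^ℓ≤n : 2 * S ^ ℓ ≤ n
        2S^ℓ≤n = begin
          2 * S ^ ℓ                      ≤⟨ *-mono-≤ (^-monoʳ-≤ 2 {1} (*-mono-≤ {1} {S} (>-nonZero⁻¹ S) 1≤ℓ))
                                                     (^-monoˡ-≤ ℓ (n≤2^n S)) ⟩
          2 ^ (S * ℓ) * (2 ^ S) ^ ℓ      ≡⟨ cong (2 ^ (S * ℓ) *_) (^-*-assoc 2 S ℓ) ⟩
          2 ^ (S * ℓ) * 2 ^ (S * ℓ)      ≡⟨ ^-distribˡ-+-* 2 (S * ℓ) (S * ℓ) ⟨
          2 ^ (S * ℓ + S * ℓ)            ≡⟨ cong (2 ^_) (twice S ℓ) ⟩
          2 ^ (ℓ * (2 * S))              ≤⟨ ^-monoʳ-≤ 2 ℓ*2S≤lg ⟩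
          2 ^ lg                         ≤⟨ 2^⌊log₂n⌋≤n n ⦃ >-nonZero (<-≤-trans (m^n>0 2 (4 * S)) 2^4S≤n) ⦄ ⟩
          n                              ∎
          where
            open ≤-Reasoning
            twice : ∀ S ℓ → S * ℓ + S * ℓ ≡ ℓ * (2 * S)
            twice = solve-∀

  -- T(n) is below the number of steps forced when a block of n and a block of A boundaries each carry
  -- pairwise distinct crossing sequences over S - 1 states.
  BelowCrossingBound : (ℕ → ℕ) → ℕ → ℕ → Set
  BelowCrossingBound T S A = ∀ n → ∃ λ ℓ → T n < ℓ * (n ∸ S ^ ℓ) + ℓ * (A ∸ S ^ ℓ)

  LittleONLogN⇒BelowCrossingBound : ∀ {T} → LittleONLogN T → ∀ S .{{_ : NonZero S}} →
                                    ∃ λ A → BelowCrossingBound T S A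
  LittleONLogN⇒BelowCrossingBound {T} o S = A , room
    where
      N₀ = proj₁ (o (8 * S))
      N  = N₀ + 2 ^ (4 * S)
      B  = sum (map T (upTo N))
      A  = S + suc B

      small : ∀ n → n < N → T n < 1 * (n ∸ S ^ 1) + 1 * (A ∸ S ^ 1)
      small n n<N = begin-strict
        T n                        ≤⟨ ∈⇒≤sum (∈-map⁺ T (∈-upTo⁺ n<N)) ⟩
        B                          <⟨ n<1+n B ⟩
        suc B                      ≡⟨ m+n∸m≡n S (suc B) ⟨
        A ∸ S                      ≡⟨ cong (A ∸_) (*-identityʳ S) ⟨
        A ∸ S ^ 1                  ≡⟨ *-identityˡ (A ∸ S ^ 1) ⟨
        1 * (A ∸ S ^ 1)            ≤⟨ m≤n+m (1 * (A ∸ S ^ 1)) (1 * (n ∸ S ^ 1)) ⟩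
        1 * (n ∸ S ^ 1) + 1 * (A ∸ S ^ 1) ∎
        where open ≤-Reasoning

      large : ∀ n → N ≤ n → ∃ λ ℓ → T n < ℓ * (n ∸ S ^ ℓ)
      large n N≤n with log-block S n (≤-trans (m≤n+m (2 ^ (4 * S)) N₀) N≤n)
      ... | ℓ , 2S^ℓ≤n , 1+lg≤4Sℓ = ℓ , *-cancelˡ-< (8 * S) (T n) (ℓ * (n ∸ S ^ ℓ)) (begin-strict
        8 * S * T n                        ≤⟨ proj₂ (o (8 * S)) n (≤-trans (m≤m+n N₀ _) N≤n) ⟩
        n * ⌊log₂ n ⌋                      <⟨ *-monoʳ-< n ⦃ n≢0 ⦄ (n<1+n ⌊log₂ n ⌋) ⟩
        n * suc ⌊log₂ n ⌋                  ≤⟨ *-mono-≤ (2*m≤n⇒n≤2*[n∸m] {S ^ ℓ} 2S^ℓ≤n) 1+lg≤4Sℓ ⟩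
        2 * (n ∸ S ^ ℓ) * (4 * S * ℓ)      ≡⟨ rearrange (n ∸ S ^ ℓ) S ℓ ⟩
        8 * S * (ℓ * (n ∸ S ^ ℓ))          ∎)
        where
          open ≤-Reasoning
          n≢0 : NonZero n
          n≢0 = >-nonZero (<-≤-trans (m^n>0 2 (4 * S)) (≤-trans (m≤n+m (2 ^ (4 * S)) N₀) N≤n))
          rearrange : ∀ x S ℓ → 2 * x * (4 * S * ℓ) ≡ 8 * S * (ℓ * x)
          rearrange = solve-∀

      room : BelowCrossingBound T S A
      room n with n <? N
      ... | yes n<N = 1 , small n n<N
      ... | no  n≮N with large n (≮⇒≥ n≮N)
      ...   | ℓ , T<ℓ[n∸S^ℓ] = ℓ , <-≤-trans T<ℓ[n∸S^ℓ] (m≤m+n _ _)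

module Machine (M : TM) where

  open Integers
  import Data.Nat.Properties as ℕ
  open import Data.Nat as ℕ using (ℕ; zero; suc)
  open import Data.Nat.ListAction using (sum)
  open Lists using (sum-map-+; sum-map-zero; sum-map-supported)
  open import Data.Integer using (ℤ; +_; _+_; _-_; _<_; _≤_)
  import Data.Integer as ℤ
  import Data.Integer.Properties as ℤ
  open import Data.Integer.Tactic.RingSolver using (solve-∀)
  open import Data.Fin using (Fin)
  open import Data.Maybe using (Maybe; just; nothing)
  open import Data.Product using (Σ; _×_; _,_; proj₁; proj₂)
  open import Data.Sum using (_⊎_; inj₁; inj₂)
  open import Data.List using (List; []; _∷_; _++_; length; map)
  open import Data.List.Relation.Binary.Permutation.Propositional using (_↭_; ↭-refl; ↭-prep; ↭-sym; ↭-trans)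
  open import Data.List.Relation.Binary.Permutation.Propositional.Properties using (shift; ∈-resp-↭)
  open import Data.List.Relation.Unary.All as All using (All; []; _∷_)
  open import Data.List.Relation.Unary.Any using (here; there)
  open import Data.List.Relation.Unary.Unique.Propositional using (Unique)
  open import Data.List.Relation.Binary.Subset.Propositional using (_⊆_)
  open import Data.List.Membership.Propositional using (_∈_)
  open import Data.List.Membership.Propositional.Properties using (∈-++⁻; ∈-++⁺ˡ; ∈-++⁺ʳ; ∈-map⁺; ∈-map⁻)
  open import Data.Bool using (Bool; true; false; _xor_; if_then_else_)
  open import Relation.Nullary using (Dec; does; yes; no; contradiction)
  open import Relation.Nullary.Decidable using (dec-true; dec-false)
  open import Relation.Binary.PropositionalEquality

  open TM M

  private
    Conf = Config M

  Tape : Set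
  Tape = ℤ → Sym

  data StepView (c : Conf) : Maybe Conf → Set where
    halts : δ (state c) (tape c (pos c)) ≡ nothing → StepView c nothing
    moves : ∀ q a m → δ (state c) (tape c (pos c)) ≡ just (q , a , m) →
            StepView c (just ⟨ q , write M (tape c) (pos c) a , moveHead M m (pos c) ⟩)

  step-view : ∀ c → StepView c (step M c)
  step-view ⟨ q , t , i ⟩ with δ q (t i) in eq
  ... | nothing          = halts eq
  ... | just (q' , a , m) = moves q' a m eq

  write-here : ∀ t i a → write M t i a i ≡ a
  write-here t i a with i ℤ.≟ i
  ... | yes _   = refl
  ... | no i≢i  = contradiction refl i≢i

  write-elsewhere : ∀ t i a {x} → x ≢ i → write M t i a x ≡ t x
  write-elsewhere t i a {x} x≢i with x ℤ.≟ i
  ... | yes x≡i = contradiction x≡i x≢i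
  ... | no _    = refl

  moveHead-+ : ∀ m i off → moveHead M m (i + off) ≡ moveHead M m i + off
  moveHead-+ L i off = i+j+k≡i+k+j i off (ℤ.- + 1)
  moveHead-+ R i off = i+j+k≡i+k+j i off (+ 1)

  step-tape : ∀ {c c'} → step M c ≡ just c' → ∀ {x} → x ≢ pos c → tape c' x ≡ tape c x
  step-tape {c} eq = go (step-view c) eq
    where
      go : ∀ {mc c'} → StepView c mc → mc ≡ just c' → ∀ {x} → x ≢ pos c → tape c' x ≡ tape c x
      go (moves q a m _) refl = write-elsewhere (tape c) (pos c) a

  step-pos : ∀ {c c'} → step M c ≡ just c' → pos c' ≡ pos c + + 1 ⊎ pos c' ≡ pos c - + 1
  step-pos {c} eq = go (step-view c) eq
    where
      go : ∀ {mc c'} → StepView c mc → mc ≡ just c' → pos c' ≡ pos c + + 1 ⊎ pos c' ≡ pos c - + 1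
      go (moves q a L _) refl = inj₂ refl
      go (moves q a R _) refl = inj₁ refl

  step-keeps-right : ∀ {b g g'} → step M g ≡ just g' → pos g < b → ∀ x → b ≤ x → tape g' x ≡ tape g x
  step-keeps-right h p<b x b≤x = step-tape h (λ x≡p → ℤ.<-irrefl (sym x≡p) (ℤ.<-≤-trans p<b b≤x))

  step-keeps-left : ∀ {b g g'} → step M g ≡ just g' → b ≤ pos g → ∀ x → x < b → tape g' x ≡ tape g x
  step-keeps-left h b≤p x x<b = step-tape h (λ x≡p → ℤ.<-irrefl x≡p (ℤ.<-≤-trans x<b b≤p))

  step-leaving-left : ∀ {b c c'} → step M c ≡ just c' → pos c < b → b ≤ pos c' → pos c' ≡ b
  step-leaving-left {b} {c} h p<b b≤p' with step-pos h
  ... | inj₁ p'≡p+1 = ℤ.≤-antisym (subst (_≤ b) (sym p'≡p+1) (i<j⇒i+1≤j p<b)) b≤p'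
  ... | inj₂ p'≡p-1 =
    contradiction (ℤ.≤-<-trans b≤p' (subst (_< pos c) (sym p'≡p-1) (i-1<i (pos c)))) (ℤ.<-asym p<b)

  step-leaving-right : ∀ {b c c'} → step M c ≡ just c' → b ≤ pos c → pos c' < b → pos c' ≡ b - + 1
  step-leaving-right {b} {c} h b≤p p'<b with step-pos h
  ... | inj₁ p'≡p+1 =
    contradiction (ℤ.≤-<-trans b≤p (subst (pos c <_) (sym p'≡p+1) (i<i+1 (pos c)))) (ℤ.<-asym p'<b)
  ... | inj₂ p'≡p-1 = trans p'≡p-1 (cong (_- + 1) (ℤ.≤-antisym p≤b b≤p))
    where
      p≤b : pos c ≤ b
      p≤b = subst (_≤ b) (i-j+j≡i (pos c) (+ 1)) (i<j⇒i+1≤j (subst (_< b) p'≡p-1 p'<b))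

  record Shifted (off : ℤ) (Cells : ℤ → Set) (c d : Conf) : Set where
    field
      state≡ : state d ≡ state c
      pos≡   : pos d ≡ pos c + off
      tape≡  : ∀ x → Cells x → tape d (x + off) ≡ tape c x
  open Shifted public

  data ShiftedStep (off : ℤ) (Cells : ℤ → Set) : Maybe Conf → Maybe Conf → Set where
    both-halt : ShiftedStep off Cells nothing nothing
    both-move : ∀ {c d} → Shifted off Cells c d → ShiftedStep off Cells (just c) (just d)

  write-shifted : ∀ {off} {Cells : ℤ → Set} {t t' : Tape} {i i'} a → i' ≡ i + off →
                  (∀ x → Cells x → t' (x + off) ≡ t x) →
                  ∀ x → Cells x → write M t' i' a (x + off) ≡ write M t i a x
  write-shifted {off} {t = t} {t'} {i} {i'} a i'≡i+off t'~t x Cells-x = by-cases (x ℤ.≟ i)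
    where
      by-cases : Dec (x ≡ i) → write M t' i' a (x + off) ≡ write M t i a x
      by-cases (yes refl) = trans (cong (λ j → write M t' j a (x + off)) i'≡i+off)
                                  (trans (write-here t' (x + off) a) (sym (write-here t x a)))
      by-cases (no x≢i) = trans (write-elsewhere t' i' a (λ eq → x≢i (+-cancelʳ-≡ off (trans eq i'≡i+off))))
                                (trans (t'~t x Cells-x) (sym (write-elsewhere t i a x≢i)))

  step-Shifted : ∀ {off Cells c d} → Shifted off Cells c d → Cells (pos c) →
                 ShiftedStep off Cells (step M c) (step M d)
  step-Shifted {off} {Cells} {c} {d} c~d Cells-pos = go (step-view c) (step-view d)
    where
      same-δ : δ (state c) (tape c (pos c)) ≡ δ (state d) (tape d (pos d))
      same-δ = cong₂ δ (sym (state≡ c~d))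
                       (trans (sym (tape≡ c~d (pos c) Cells-pos)) (cong (tape d) (sym (pos≡ c~d))))

      go : ∀ {mc md} → StepView c mc → StepView d md → ShiftedStep off Cells mc md
      go (halts _) (halts _) = both-halt
      go (halts h) (moves _ _ _ m) = contradiction (trans (sym h) (trans same-δ m)) λ ()
      go (moves _ _ _ m) (halts h) = contradiction (trans (sym h) (trans (sym same-δ) m)) λ ()
      go (moves q a m δc) (moves q' a' m' δd) with trans (sym δc) (trans same-δ δd)
      ... | refl = both-move (record
        { state≡ = refl
        ; pos≡   = trans (cong (moveHead M m) (pos≡ c~d)) (moveHead-+ m (pos c) off)
        ; tape≡  = write-shifted a (pos≡ c~d) (tape≡ c~d) })

  ShiftedStep-just : ∀ {off Cells mc md c'} → ShiftedStep off Cells mc md → mc ≡ just c' →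
                     Σ Conf λ d' → md ≡ just d' × Shifted off Cells c' d'
  ShiftedStep-just (both-move c~d) refl = _ , refl , c~d

  ShiftedStep-nothing : ∀ {off Cells mc md} → ShiftedStep off Cells mc md → mc ≡ nothing → md ≡ nothing
  ShiftedStep-nothing both-halt refl = refl

  data Execution : Conf → ℕ → List ℤ → Set where
    stop : ∀ {c} → step M c ≡ nothing → Execution c 0 (pos c ∷ [])
    go   : ∀ {c c' k ps} → step M c ≡ just c' → Execution c' k ps → Execution c (suc k) (pos c ∷ ps)

  Execution-deterministic : ∀ {c k k' ps ps'} → Execution c k ps → Execution c k' ps' → k ≡ k' × ps ≡ ps'
  Execution-deterministic (stop _) (stop _) = refl , refl
  Execution-deterministic (stop h) (go h' _) = contradiction (trans (sym h) h') λ ()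
  Execution-deterministic (go h _) (stop h') = contradiction (trans (sym h') h) λ ()
  Execution-deterministic (go h e) (go h' e') with trans (sym h) h'
  ... | refl with Execution-deterministic e e'
  ...   | refl , refl = refl , refl

  HaltsAfter⇒Execution : ∀ {w k} → HaltsAfter M w k →
                         Execution (initConfig M w) k (trace M k (initConfig M w))
  HaltsAfter⇒Execution {w} {k} (final , run≡final , halted) = go-run k (initConfig M w) run≡final
    where
      go-run : ∀ k c → run M k c ≡ just final → Execution c k (trace M k c)
      go-run zero    c refl = stop halted
      go-run (suc k) c run≡ with step M c in step≡
      ... | just c' = go step≡ (go-run k c' run≡)

  trace⊆visits : ∀ {c k ps} → Execution c k ps → ∀ t → trace M t c ⊆ ps
  trace⊆visits (stop _) zero (here refl) = here refl
  trace⊆visits (go _ _) zero (here refl) = here refl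
  trace⊆visits {c} (stop halted) (suc t) x∈ with step M c | halted
  ... | .nothing | refl = x∈
  trace⊆visits {c} (go stepped E) (suc t) x∈ with step M c | stepped
  ... | .(just _) | refl with x∈
  ...   | here x≡p   = here x≡p
  ...   | there x∈tr = there (trace⊆visits E t x∈tr)

  -- A run confined to the cells < b, cut at every crossing of the boundary between b - 1 and b;
  -- cs lists the states in which these crossings happen. While the head is to the right of b the
  -- cells < b do not change, so each return is resumed on the tape t left behind.
  mutual
    data LeftRun (b : ℤ) : Conf → List (Fin nQ) → List ℤ → Set where
      halt  : ∀ {c} → pos c < b → step M c ≡ nothing → LeftRun b c [] (pos c ∷ [])
      stay  : ∀ {c c' cs ps} → pos c < b → step M c ≡ just c' → pos c' < b →
              LeftRun b c' cs ps → LeftRun b c cs (pos c ∷ ps)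
      leave : ∀ {c c' cs ps} → pos c < b → step M c ≡ just c' → b ≤ pos c' →
              LeftResume b (tape c') cs ps → LeftRun b c (state c' ∷ cs) (pos c ∷ ps)

    data LeftResume (b : ℤ) : Tape → List (Fin nQ) → List ℤ → Set where
      done   : ∀ {t} → LeftResume b t [] []
      resume : ∀ {t q cs ps} → LeftRun b ⟨ q , t , b - + 1 ⟩ cs ps → LeftResume b t (q ∷ cs) ps

  mutual
    data RightRun (b : ℤ) : Conf → List (Fin nQ) → List ℤ → Set where
      halt  : ∀ {c} → b ≤ pos c → step M c ≡ nothing → RightRun b c [] (pos c ∷ [])
      stay  : ∀ {c c' cs ps} → b ≤ pos c → step M c ≡ just c' → b ≤ pos c' →
              RightRun b c' cs ps → RightRun b c cs (pos c ∷ ps)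
      leave : ∀ {c c' cs ps} → b ≤ pos c → step M c ≡ just c' → pos c' < b →
              RightResume b (tape c') cs ps → RightRun b c (state c' ∷ cs) (pos c ∷ ps)

    data RightResume (b : ℤ) : Tape → List (Fin nQ) → List ℤ → Set where
      done   : ∀ {t} → RightResume b t [] []
      resume : ∀ {t q cs ps} → RightRun b ⟨ q , t , b ⟩ cs ps → RightResume b t (q ∷ cs) ps

  mutual
    LeftRun-positions : ∀ {b c cs ps} → LeftRun b c cs ps → All (_< b) ps
    LeftRun-positions (halt p<b _)      = p<b ∷ []
    LeftRun-positions (stay p<b _ _ r)  = p<b ∷ LeftRun-positions r
    LeftRun-positions (leave p<b _ _ r) = p<b ∷ LeftResume-positions r

    LeftResume-positions : ∀ {b t cs ps} → LeftResume b t cs ps → All (_< b) ps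
    LeftResume-positions done       = []
    LeftResume-positions (resume r) = LeftRun-positions r

  mutual
    RightRun-positions : ∀ {b c cs ps} → RightRun b c cs ps → All (b ≤_) ps
    RightRun-positions (halt b≤p _)      = b≤p ∷ []
    RightRun-positions (stay b≤p _ _ r)  = b≤p ∷ RightRun-positions r
    RightRun-positions (leave b≤p _ _ r) = b≤p ∷ RightResume-positions r

    RightResume-positions : ∀ {b t cs ps} → RightResume b t cs ps → All (b ≤_) ps
    RightResume-positions done       = []
    RightResume-positions (resume r) = RightRun-positions r

  private
    shifted-< : ∀ {off b x y} → y ≡ x + off → x < b → y < b + off
    shifted-< {off} refl x<b = ℤ.+-monoˡ-< off x<b

    shifted-≤ : ∀ {off b x y} → y ≡ x + off → b ≤ x → b + off ≤ y
    shifted-≤ {off} refl b≤x = ℤ.+-monoˡ-≤ off b≤x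

    b+off-1 : ∀ b off → b + off - + 1 ≡ b - + 1 + off
    b+off-1 = solve-∀

  mutual
    LeftRun-shift : ∀ {b off c d cs ps} → LeftRun b c cs ps → Shifted off (_< b) c d →
                    LeftRun (b + off) d cs (map (_+ off) ps)
    LeftRun-shift {b} {off} {d = d} (halt p<b h) c~d =
      subst (λ i → LeftRun (b + off) d [] (i ∷ [])) (pos≡ c~d)
        (halt (shifted-< (pos≡ c~d) p<b) (ShiftedStep-nothing (step-Shifted c~d p<b) h))
    LeftRun-shift {b} {off} {d = d} (stay p<b h p'<b r) c~d
      with d' , h' , c'~d' ← ShiftedStep-just (step-Shifted c~d p<b) h =
      subst (λ i → LeftRun (b + off) d _ (i ∷ _)) (pos≡ c~d)
        (stay (shifted-< (pos≡ c~d) p<b) h' (shifted-< (pos≡ c'~d') p'<b) (LeftRun-shift r c'~d'))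
    LeftRun-shift {b} {off} {d = d} (leave {cs = cs} p<b h b≤p' r) c~d
      with d' , h' , c'~d' ← ShiftedStep-just (step-Shifted c~d p<b) h =
      subst₂ (λ i q → LeftRun (b + off) d (q ∷ cs) (i ∷ _)) (pos≡ c~d) (state≡ c'~d')
        (leave (shifted-< (pos≡ c~d) p<b) h' (shifted-≤ (pos≡ c'~d') b≤p') (LeftResume-shift r (tape≡ c'~d')))

    LeftResume-shift : ∀ {b off t t' cs ps} → LeftResume b t cs ps → (∀ x → x < b → t' (x + off) ≡ t x) →
                       LeftResume (b + off) t' cs (map (_+ off) ps)
    LeftResume-shift done _ = done
    LeftResume-shift {b} {off} (resume r) t~t' =
      resume (LeftRun-shift r (record { state≡ = refl ; pos≡ = b+off-1 b off ; tape≡ = t~t' }))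

  mutual
    RightRun-shift : ∀ {b off c d cs ps} → RightRun b c cs ps → Shifted off (b ≤_) c d →
                     RightRun (b + off) d cs (map (_+ off) ps)
    RightRun-shift {b} {off} {d = d} (halt b≤p h) c~d =
      subst (λ i → RightRun (b + off) d [] (i ∷ [])) (pos≡ c~d)
        (halt (shifted-≤ (pos≡ c~d) b≤p) (ShiftedStep-nothing (step-Shifted c~d b≤p) h))
    RightRun-shift {b} {off} {d = d} (stay b≤p h b≤p' r) c~d
      with d' , h' , c'~d' ← ShiftedStep-just (step-Shifted c~d b≤p) h =
      subst (λ i → RightRun (b + off) d _ (i ∷ _)) (pos≡ c~d)
        (stay (shifted-≤ (pos≡ c~d) b≤p) h' (shifted-≤ (pos≡ c'~d') b≤p') (RightRun-shift r c'~d'))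
    RightRun-shift {b} {off} {d = d} (leave {cs = cs} b≤p h p'<b r) c~d
      with d' , h' , c'~d' ← ShiftedStep-just (step-Shifted c~d b≤p) h =
      subst₂ (λ i q → RightRun (b + off) d (q ∷ cs) (i ∷ _)) (pos≡ c~d) (state≡ c'~d')
        (leave (shifted-≤ (pos≡ c~d) b≤p) h' (shifted-< (pos≡ c'~d') p'<b) (RightResume-shift r (tape≡ c'~d')))

    RightResume-shift : ∀ {b off t t' cs ps} → RightResume b t cs ps → (∀ x → b ≤ x → t' (x + off) ≡ t x) →
                        RightResume (b + off) t' cs (map (_+ off) ps)
    RightResume-shift done _ = done
    RightResume-shift (resume r) t~t' =
      resume (RightRun-shift r (record { state≡ = refl ; pos≡ = refl ; tape≡ = t~t' }))

  agreement : ∀ {Cells c d} → state d ≡ state c → pos d ≡ pos c → (∀ x → Cells x → tape d x ≡ tape c x) →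
              Shifted (+ 0) Cells c d
  agreement {c = c} {d} s≡ p≡ t≡ = record
    { state≡ = s≡
    ; pos≡   = trans p≡ (sym (ℤ.+-identityʳ (pos c)))
    ; tape≡  = λ x Cx → trans (cong (tape d) (ℤ.+-identityʳ x)) (t≡ x Cx) }

  agreement-pos : ∀ {Cells c d} → Shifted (+ 0) Cells c d → pos d ≡ pos c
  agreement-pos {c = c} c~d = trans (pos≡ c~d) (ℤ.+-identityʳ (pos c))

  agreement-tape : ∀ {Cells c d} → Shifted (+ 0) Cells c d → ∀ x → Cells x → tape d x ≡ tape c x
  agreement-tape {d = d} c~d x Cx = trans (cong (tape d) (sym (ℤ.+-identityʳ x))) (tape≡ c~d x Cx)

  private
    map-+0 : ∀ ps → map (_+ + 0) ps ≡ ps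
    map-+0 []       = refl
    map-+0 (p ∷ ps) = cong₂ _∷_ (ℤ.+-identityʳ p) (map-+0 ps)

  LeftRun-agree : ∀ {b c d cs ps} → LeftRun b c cs ps → Shifted (+ 0) (_< b) c d → LeftRun b d cs ps
  LeftRun-agree {b} {d = d} {cs} {ps} r c~d =
    subst₂ (λ b' ps' → LeftRun b' d cs ps') (ℤ.+-identityʳ b) (map-+0 ps) (LeftRun-shift r c~d)

  RightRun-agree : ∀ {b c d cs ps} → RightRun b c cs ps → Shifted (+ 0) (b ≤_) c d → RightRun b d cs ps
  RightRun-agree {b} {d = d} {cs} {ps} r c~d =
    subst₂ (λ b' ps' → RightRun b' d cs ps') (ℤ.+-identityʳ b) (map-+0 ps) (RightRun-shift r c~d)

  LeftResume-agree : ∀ {b t t' cs ps} → LeftResume b t cs ps → (∀ x → x < b → t' x ≡ t x) →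
                     LeftResume b t' cs ps
  LeftResume-agree done       _    = done
  LeftResume-agree (resume r) t~t' = resume (LeftRun-agree r (agreement refl refl t~t'))

  RightResume-agree : ∀ {b t t' cs ps} → RightResume b t cs ps → (∀ x → b ≤ x → t' x ≡ t x) →
                      RightResume b t' cs ps
  RightResume-agree done       _    = done
  RightResume-agree (resume r) t~t' = resume (RightRun-agree r (agreement refl refl t~t'))

  left-of : ℤ → ℤ → Bool
  left-of b p = does (p ℤ.<? b)

  -- 1 if moving the head from p to q crosses the boundary between the cells b - 1 and b.
  step-crossing : ℤ → ℤ → ℤ → ℕ
  step-crossing b p q = if left-of b p xor left-of b q then 1 else 0

  crossings : ℤ → ∀ {c k ps} → Execution c k ps → ℕ
  crossings b (stop _) = 0
  crossings b (go {c} {c'} _ E) = step-crossing b (pos c) (pos c') ℕ.+ crossings b E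

  private
    left-of-< : ∀ {b p} → p < b → left-of b p ≡ true
    left-of-< {b} {p} p<b = dec-true (p ℤ.<? b) p<b

    left-of-≥ : ∀ {b p} → b ≤ p → left-of b p ≡ false
    left-of-≥ {b} {p} b≤p = dec-false (p ℤ.<? b) (ℤ.≤⇒≯ b≤p)

    no-crossing-left : ∀ {b p q} → p < b → q < b → step-crossing b p q ≡ 0
    no-crossing-left p<b q<b rewrite left-of-< p<b | left-of-< q<b = refl

    no-crossing-right : ∀ {b p q} → b ≤ p → b ≤ q → step-crossing b p q ≡ 0
    no-crossing-right b≤p b≤q rewrite left-of-≥ b≤p | left-of-≥ b≤q = refl

    crossing-rightwards : ∀ {b p q} → p < b → b ≤ q → step-crossing b p q ≡ 1
    crossing-rightwards p<b b≤q rewrite left-of-< p<b | left-of-≥ b≤q = refl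

    crossing-leftwards : ∀ {b p q} → b ≤ p → q < b → step-crossing b p q ≡ 1
    crossing-leftwards b≤p q<b rewrite left-of-≥ b≤p | left-of-< q<b = refl

    beside-unit-step : ∀ {b x} → b ≢ x + + 1 → (x < b × x + + 1 < b) ⊎ (b ≤ x × b ≤ x + + 1)
    beside-unit-step {b} {x} b≢x+1 with b ℤ.<? x + + 1
    ... | yes b<x+1 = inj₂ (i<j+1⇒i≤j b<x+1 , ℤ.<⇒≤ b<x+1)
    ... | no  b≮x+1 = inj₁ (ℤ.<-trans (i<i+1 x) x+1<b , x+1<b)
      where x+1<b = ℤ.≤∧≢⇒< (ℤ.≮⇒≥ b≮x+1) (≢-sym b≢x+1)

    no-unit-crossing : ∀ {b x p q} → b ≢ x + + 1 → (p ≡ x × q ≡ x + + 1) ⊎ (p ≡ x + + 1 × q ≡ x) →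
                       step-crossing b p q ≡ 0
    no-unit-crossing {b} {x} b≢x+1 p,q with beside-unit-step {b} {x} b≢x+1 | p,q
    ... | inj₁ (x<b , x+1<b) | inj₁ (refl , refl) = no-crossing-left x<b x+1<b
    ... | inj₁ (x<b , x+1<b) | inj₂ (refl , refl) = no-crossing-left x+1<b x<b
    ... | inj₂ (b≤x , b≤x+1) | inj₁ (refl , refl) = no-crossing-right b≤x b≤x+1
    ... | inj₂ (b≤x , b≤x+1) | inj₂ (refl , refl) = no-crossing-right b≤x+1 b≤x

  step-crossing-single : ∀ {c c'} → step M c ≡ just c' →
                         Σ ℤ λ v → ∀ b → b ≢ v → step-crossing b (pos c) (pos c') ≡ 0
  step-crossing-single {c} {c'} h with step-pos h
  ... | inj₁ p'≡p+1 = pos c + + 1 , λ b b≢v → no-unit-crossing {x = pos c} b≢v (inj₁ (refl , p'≡p+1))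
  ... | inj₂ p'≡p-1 = pos c , λ b b≢v →
    no-unit-crossing {x = pos c'} (subst (b ≢_) p≡p'+1 b≢v) (inj₂ (p≡p'+1 , refl))
    where
      p≡p'+1 : pos c ≡ pos c' + + 1
      p≡p'+1 = trans (sym (i-j+j≡i (pos c) (+ 1))) (cong (_+ + 1) (sym p'≡p-1))

  step-crossing≤1 : ∀ b p q → step-crossing b p q ℕ.≤ 1
  step-crossing≤1 b p q with left-of b p xor left-of b q
  ... | true  = ℕ.≤-refl
  ... | false = ℕ.z≤n

  -- Each step crosses a single boundary, so distinct boundaries share the steps.
  sum-crossings≤steps : ∀ {c k ps} (E : Execution c k ps) {bs} → Unique bs →
                        sum (map (λ b → crossings b E) bs) ℕ.≤ k
  sum-crossings≤steps (stop _) {bs} _ = ℕ.≤-reflexive (sum-map-zero {xs = bs} (All.tabulate (λ _ → refl)))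
  sum-crossings≤steps (go {c} {c'} {k} h E) {bs} u = begin
    sum (map (λ b → step-crossing b (pos c) (pos c') ℕ.+ crossings b E) bs)
      ≡⟨ sum-map-+ (λ b → step-crossing b (pos c) (pos c')) (λ b → crossings b E) bs ⟩
    sum (map (λ b → step-crossing b (pos c) (pos c')) bs) ℕ.+ sum (map (λ b → crossings b E) bs)
      ≤⟨ ℕ.+-mono-≤ single (sum-crossings≤steps E u) ⟩
    suc k ∎
    where
      open ℕ.≤-Reasoning
      v = proj₁ (step-crossing-single h)
      single : sum (map (λ b → step-crossing b (pos c) (pos c')) bs) ℕ.≤ 1
      single = ℕ.≤-trans (sum-map-supported ℤ._≟_ u (proj₂ (step-crossing-single h)))
                         (step-crossing≤1 v (pos c) (pos c'))

  record LeftSplit (b : ℤ) {g k ps} (E : Execution g k ps) : Set where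
    field
      crossing        : List (Fin nQ)
      psL psR         : List ℤ
      left            : LeftRun b g crossing psL
      right           : RightResume b (tape g) crossing psR
      positions       : ps ↭ psL ++ psR
      length-crossing : length crossing ≡ crossings b E

  record RightSplit (b : ℤ) {g k ps} (E : Execution g k ps) : Set where
    field
      crossing        : List (Fin nQ)
      psL psR         : List ℤ
      right           : RightRun b g crossing psR
      left            : LeftResume b (tape g) crossing psL
      positions       : ps ↭ psL ++ psR
      length-crossing : length crossing ≡ crossings b E

  mutual
    split-left : ∀ {b g k ps} (E : Execution g k ps) → pos g < b → LeftSplit b E
    split-left (stop h) p<b = record
      { crossing = [] ; psL = _ ; psR = []
      ; left = halt p<b h ; right = done ; positions = ↭-refl ; length-crossing = refl }
    split-left {b} {g} (go {c' = g'} h E) p<b with pos g' ℤ.<? b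
    ... | yes p'<b = record
      { crossing = crossing ; psL = pos g ∷ psL ; psR = psR
      ; left = stay p<b h p'<b left
      ; right = RightResume-agree right (λ x b≤x → sym (step-keeps-right h p<b x b≤x))
      ; positions = ↭-prep (pos g) positions
      ; length-crossing = trans length-crossing (cong (ℕ._+ crossings b E) (sym (no-crossing-left p<b p'<b))) }
      where open LeftSplit (split-left E p'<b)
    ... | no p'≮b = record
      { crossing = state g' ∷ crossing ; psL = pos g ∷ psL ; psR = psR
      ; left = leave p<b h b≤p' left
      ; right = resume (RightRun-agree right
                  (agreement refl (sym (step-leaving-left h p<b b≤p')) (λ x b≤x → sym (step-keeps-right h p<b x b≤x))))
      ; positions = ↭-prep (pos g) positions
      ; length-crossing =
          trans (cong suc length-crossing) (cong (ℕ._+ crossings b E) (sym (crossing-rightwards p<b b≤p'))) }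
      where
        b≤p' = ℤ.≮⇒≥ p'≮b
        open RightSplit (split-right E b≤p')

    split-right : ∀ {b g k ps} (E : Execution g k ps) → b ≤ pos g → RightSplit b E
    split-right (stop h) b≤p = record
      { crossing = [] ; psL = [] ; psR = _
      ; right = halt b≤p h ; left = done ; positions = ↭-refl ; length-crossing = refl }
    split-right {b} {g} (go {c' = g'} h E) b≤p with pos g' ℤ.<? b
    ... | no p'≮b = record
      { crossing = crossing ; psL = psL ; psR = pos g ∷ psR
      ; right = stay b≤p h b≤p' right
      ; left = LeftResume-agree left (λ x x<b → sym (step-keeps-left h b≤p x x<b))
      ; positions = ↭-trans (↭-prep (pos g) positions) (↭-sym (shift (pos g) psL psR))
      ; length-crossing = trans length-crossing (cong (ℕ._+ crossings b E) (sym (no-crossing-right b≤p b≤p'))) }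
      where
        b≤p' = ℤ.≮⇒≥ p'≮b
        open RightSplit (split-right E b≤p')
    ... | yes p'<b = record
      { crossing = state g' ∷ crossing ; psL = psL ; psR = pos g ∷ psR
      ; right = leave b≤p h p'<b right
      ; left = resume (LeftRun-agree left
                 (agreement refl (sym (step-leaving-right h b≤p p'<b)) (λ x x<b → sym (step-keeps-left h b≤p x x<b))))
      ; positions = ↭-trans (↭-prep (pos g) positions) (↭-sym (shift (pos g) psL psR))
      ; length-crossing =
          trans (cong suc length-crossing) (cong (ℕ._+ crossings b E) (sym (crossing-leftwards b≤p p'<b))) }
      where open LeftSplit (split-left E p'<b)

  record Execution↭ (g : Conf) (qs : List ℤ) : Set where
    field
      steps     : ℕ
      visits    : List ℤ
      execution : Execution g steps visits
      visits↭   : visits ↭ qs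

  private
    ↭-cons : ∀ {p q : ℤ} {xs ys} → p ≡ q → xs ↭ ys → p ∷ xs ↭ q ∷ ys
    ↭-cons refl = ↭-prep _

    keeps-right : ∀ {b c g g'} {t : Tape} → Shifted (+ 0) (_< b) c g → step M g ≡ just g' → pos c < b →
                  (∀ x → b ≤ x → tape g x ≡ t x) → ∀ x → b ≤ x → tape g' x ≡ t x
    keeps-right {b} c~g h p<b g~t x b≤x =
      trans (step-keeps-right h (subst (_< b) (sym (agreement-pos c~g)) p<b) x b≤x) (g~t x b≤x)

    keeps-left : ∀ {b c g g'} {t : Tape} → Shifted (+ 0) (b ≤_) c g → step M g ≡ just g' → b ≤ pos c →
                 (∀ x → x < b → tape g x ≡ t x) → ∀ x → x < b → tape g' x ≡ t x
    keeps-left {b} c~g h b≤p g~t x x<b =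
      trans (step-keeps-left h (subst (b ≤_) (sym (agreement-pos c~g)) b≤p) x x<b) (g~t x x<b)

  Execution↭-go : ∀ {g g' p qs} → step M g ≡ just g' → pos g ≡ p → Execution↭ g' qs →
                  Execution↭ g (p ∷ qs)
  Execution↭-go h p≡ J = record { execution = go h execution ; visits↭ = ↭-cons p≡ visits↭ }
    where open Execution↭ J

  Execution↭-go-middle : ∀ {g g' p} ys zs → step M g ≡ just g' → pos g ≡ p → Execution↭ g' (ys ++ zs) →
                         Execution↭ g (ys ++ p ∷ zs)
  Execution↭-go-middle {p = p} ys zs h p≡ J = record
    { execution = go h execution ; visits↭ = ↭-trans (↭-cons p≡ visits↭) (↭-sym (shift p ys zs)) }
    where open Execution↭ J

  -- Pasting: a left run and a right run with the same crossing sequence combine into an execution.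
  mutual
    join-left : ∀ {b c t cs psL psR} → LeftRun b c cs psL → RightResume b t cs psR →
                ∀ {g} → Shifted (+ 0) (_< b) c g → (∀ x → b ≤ x → tape g x ≡ t x) → Execution↭ g (psL ++ psR)
    join-left (halt p<b h) done c~g _ = record
      { execution = stop (ShiftedStep-nothing (step-Shifted c~g p<b) h)
      ; visits↭ = ↭-cons (agreement-pos c~g) ↭-refl }
    join-left (stay p<b h p'<b l) r c~g g~t
      with g' , h' , c'~g' ← ShiftedStep-just (step-Shifted c~g p<b) h =
      Execution↭-go h' (agreement-pos c~g) (join-left l r c'~g' (keeps-right c~g h' p<b g~t))
    join-left (leave p<b h b≤p' l) (resume r) c~g g~t
      with g' , h' , c'~g' ← ShiftedStep-just (step-Shifted c~g p<b) h =
      Execution↭-go h' (agreement-pos c~g) (join-right r l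
        (agreement (state≡ c'~g') (trans (agreement-pos c'~g') (step-leaving-left h p<b b≤p'))
                   (keeps-right c~g h' p<b g~t))
        (agreement-tape c'~g'))

    join-right : ∀ {b c t cs psL psR} → RightRun b c cs psR → LeftResume b t cs psL →
                 ∀ {g} → Shifted (+ 0) (b ≤_) c g → (∀ x → x < b → tape g x ≡ t x) → Execution↭ g (psL ++ psR)
    join-right (halt b≤p h) done c~g _ = record
      { execution = stop (ShiftedStep-nothing (step-Shifted c~g b≤p) h)
      ; visits↭ = ↭-cons (agreement-pos c~g) ↭-refl }
    join-right {psL = psL} (stay {ps = psR} b≤p h b≤p' r) l c~g g~t
      with g' , h' , c'~g' ← ShiftedStep-just (step-Shifted c~g b≤p) h =
      Execution↭-go-middle psL psR h' (agreement-pos c~g) (join-right r l c'~g' (keeps-left c~g h' b≤p g~t))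
    join-right {psL = psL} (leave {ps = psR} b≤p h p'<b r) (resume l) c~g g~t
      with g' , h' , c'~g' ← ShiftedStep-just (step-Shifted c~g b≤p) h =
      Execution↭-go-middle psL psR h' (agreement-pos c~g) (join-left l r
        (agreement (state≡ c'~g') (trans (agreement-pos c'~g') (step-leaving-right h b≤p p'<b))
                   (keeps-left c~g h' b≤p g~t))
        (agreement-tape c'~g'))

  private
    ∈-left-part : ∀ {b z ps psL psR} → ps ↭ psL ++ psR → All (b ≤_) psR → z ∈ ps → z < b → z ∈ psL
    ∈-left-part {psL = psL} ps↭ right z∈ps z<b with ∈-++⁻ psL (∈-resp-↭ ps↭ z∈ps)
    ... | inj₁ z∈psL = z∈psL
    ... | inj₂ z∈psR = contradiction (All.lookup right z∈psR) (ℤ.<⇒≱ z<b)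

    ∈-right-part : ∀ {b z ps psL psR} → ps ↭ psL ++ psR → All (_< b) psL → z ∈ ps → b ≤ z → z ∈ psR
    ∈-right-part {psL = psL} ps↭ left z∈ps b≤z with ∈-++⁻ psL (∈-resp-↭ ps↭ z∈ps)
    ... | inj₁ z∈psL = contradiction b≤z (ℤ.<⇒≱ (All.lookup left z∈psL))
    ... | inj₂ z∈psR = z∈psR

  crossing-sequence : ∀ {g k ps} → Execution g k ps → ℤ → List (Fin nQ)
  crossing-sequence {g} E b with pos g ℤ.<? b
  ... | yes p<b = LeftSplit.crossing (split-left E p<b)
  ... | no  p≮b = RightSplit.crossing (split-right E (ℤ.≮⇒≥ p≮b))

  length-crossing-sequence : ∀ {g k ps} (E : Execution g k ps) b → length (crossing-sequence E b) ≡ crossings b E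
  length-crossing-sequence {g} E b with pos g ℤ.<? b
  ... | yes p<b = LeftSplit.length-crossing (split-left E p<b)
  ... | no  p≮b = RightSplit.length-crossing (split-right E (ℤ.≮⇒≥ p≮b))

  crossing-sequence-left : ∀ {g k ps b} (E : Execution g k ps) (p<b : pos g < b) →
                           crossing-sequence E b ≡ LeftSplit.crossing (split-left E p<b)
  crossing-sequence-left {g} {b = b} E p<b with pos g ℤ.<? b
  ... | yes p<b' = cong (λ p<b → LeftSplit.crossing (split-left E p<b)) (ℤ.<-irrelevant p<b' p<b)
  ... | no  p≮b  = contradiction p<b p≮b

  crossing-sequence-right : ∀ {g k ps b} (E : Execution g k ps) (b≤p : b ≤ pos g) →
                            crossing-sequence E b ≡ RightSplit.crossing (split-right E b≤p)
  crossing-sequence-right {g} {b = b} E b≤p with pos g ℤ.<? b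
  ... | yes p<b = contradiction b≤p (ℤ.<⇒≱ p<b)
  ... | no  p≮b = cong (λ b≤p → RightSplit.crossing (split-right E b≤p)) (ℤ.≤-irrelevant (ℤ.≮⇒≥ p≮b) b≤p)

  -- The execution obtained by removing the tape segment between two boundaries with equal crossing
  -- sequences: cells in Kept stay where they are, those in Moved are translated by off.
  record Cut (Kept Moved : ℤ → Set) (off : ℤ) (ps : List ℤ) (g : Conf) : Set where
    field
      steps     : ℕ
      visits    : List ℤ
      execution : Execution g steps visits
      kept      : ∀ {z} → z ∈ ps → Kept z → z ∈ visits
      moved     : ∀ {z} → z ∈ ps → Moved z → z + off ∈ visits
      visits⊆   : ∀ {z} → z ∈ visits → Kept z ⊎ Σ ℤ λ y → y ∈ ps × z ≡ y + off

  cut-right : ∀ {g k ps b₁ b₂} (E : Execution g k ps) → pos g < b₁ → b₁ < b₂ →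
              crossing-sequence E b₁ ≡ crossing-sequence E b₂ →
              ∀ {g'} → Shifted (+ 0) (_< b₁) g g' → (∀ x → b₂ ≤ x → tape g' (x + (b₁ - b₂)) ≡ tape g x) →
              Cut (_< b₁) (b₂ ≤_) (b₁ - b₂) ps g'
  cut-right {g} {ps = ps} {b₁} {b₂} E p<b₁ b₁<b₂ cs≡ {g'} g~g' tape-shifted = record
    { steps = steps ; visits = visits ; execution = execution
    ; kept = λ z∈ps z<b₁ → ∈-visits (∈-++⁺ˡ
                (∈-left-part S₁.positions (RightResume-positions S₁.right) z∈ps z<b₁))
    ; moved = λ z∈ps b₂≤z → ∈-visits (∈-++⁺ʳ S₁.psL
                (∈-map⁺ (_+ off) (∈-right-part S₂.positions (LeftRun-positions S₂.left) z∈ps b₂≤z)))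
    ; visits⊆ = λ z∈ → origin (∈-++⁻ S₁.psL (∈-resp-↭ visits↭ z∈)) }
    where
      off = b₁ - b₂
      module S₁ = LeftSplit (split-left E p<b₁)
      module S₂ = LeftSplit (split-left E (ℤ.<-trans p<b₁ b₁<b₂))
      same-crossing : S₂.crossing ≡ S₁.crossing
      same-crossing = trans (sym (crossing-sequence-left E _)) (trans (sym cs≡) (crossing-sequence-left E p<b₁))
      b₂+off≡b₁ : b₂ + off ≡ b₁
      b₂+off≡b₁ = j+[i-j]≡i b₁ b₂
      right : RightResume b₁ (tape g') S₁.crossing (map (_+ off) S₂.psR)
      right = subst₂ (λ b cs → RightResume b (tape g') cs (map (_+ off) S₂.psR)) b₂+off≡b₁ same-crossing
                     (RightResume-shift S₂.right tape-shifted)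
      open Execution↭ (join-left S₁.left right g~g' (λ _ _ → refl))
      ∈-visits : ∀ {z} → z ∈ S₁.psL ++ map (_+ off) S₂.psR → z ∈ visits
      ∈-visits = ∈-resp-↭ (↭-sym visits↭)
      origin : ∀ {z} → z ∈ S₁.psL ⊎ z ∈ map (_+ off) S₂.psR → z < b₁ ⊎ Σ ℤ λ y → y ∈ ps × z ≡ y + off
      origin (inj₁ z∈psL) = inj₁ (All.lookup (LeftRun-positions S₁.left) z∈psL)
      origin (inj₂ z∈map) with y , y∈psR , z≡y+off ← ∈-map⁻ (_+ off) z∈map =
        inj₂ (y , ∈-resp-↭ (↭-sym S₂.positions) (∈-++⁺ʳ S₂.psL y∈psR) , z≡y+off)

  cut-left : ∀ {g k ps b₁ b₂} (E : Execution g k ps) → b₁ < b₂ → b₂ ≤ pos g →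
             crossing-sequence E b₁ ≡ crossing-sequence E b₂ →
             ∀ {g'} → Shifted (+ 0) (b₂ ≤_) g g' → (∀ x → x < b₁ → tape g' (x + (b₂ - b₁)) ≡ tape g x) →
             Cut (b₂ ≤_) (_< b₁) (b₂ - b₁) ps g'
  cut-left {g} {ps = ps} {b₁} {b₂} E b₁<b₂ b₂≤p cs≡ {g'} g~g' tape-shifted = record
    { steps = steps ; visits = visits ; execution = execution
    ; kept = λ z∈ps b₂≤z → ∈-visits (∈-++⁺ʳ (map (_+ off) S₁.psL)
                (∈-right-part S₂.positions (LeftResume-positions S₂.left) z∈ps b₂≤z))
    ; moved = λ z∈ps z<b₁ → ∈-visits (∈-++⁺ˡ
                (∈-map⁺ (_+ off) (∈-left-part S₁.positions (RightRun-positions S₁.right) z∈ps z<b₁)))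
    ; visits⊆ = λ z∈ → origin (∈-++⁻ (map (_+ off) S₁.psL) (∈-resp-↭ visits↭ z∈)) }
    where
      off = b₂ - b₁
      module S₁ = RightSplit (split-right E (ℤ.≤-trans (ℤ.<⇒≤ b₁<b₂) b₂≤p))
      module S₂ = RightSplit (split-right E b₂≤p)
      same-crossing : S₁.crossing ≡ S₂.crossing
      same-crossing = trans (sym (crossing-sequence-right E _)) (trans cs≡ (crossing-sequence-right E b₂≤p))
      b₁+off≡b₂ : b₁ + off ≡ b₂
      b₁+off≡b₂ = j+[i-j]≡i b₂ b₁
      left : LeftResume b₂ (tape g') S₂.crossing (map (_+ off) S₁.psL)
      left = subst₂ (λ b cs → LeftResume b (tape g') cs (map (_+ off) S₁.psL)) b₁+off≡b₂ same-crossing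
                    (LeftResume-shift S₁.left tape-shifted)
      open Execution↭ (join-right S₂.right left g~g' (λ _ _ → refl))
      ∈-visits : ∀ {z} → z ∈ map (_+ off) S₁.psL ++ S₂.psR → z ∈ visits
      ∈-visits = ∈-resp-↭ (↭-sym visits↭)
      origin : ∀ {z} → z ∈ map (_+ off) S₁.psL ⊎ z ∈ S₂.psR → b₂ ≤ z ⊎ Σ ℤ λ y → y ∈ ps × z ≡ y + off
      origin (inj₂ z∈psR) = inj₁ (All.lookup (RightRun-positions S₂.right) z∈psR)
      origin (inj₁ z∈map) with y , y∈psL , z≡y+off ← ∈-map⁻ (_+ off) z∈map =
        inj₂ (y , ∈-resp-↭ (↭-sym S₁.positions) (∈-++⁺ˡ y∈psL) , z≡y+off)

module InputTape (M : TM) where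

  open Integers
  open import Data.Nat as ℕ using (ℕ; zero; suc; _∸_)
  import Data.Nat.Properties as ℕ
  open import Data.Integer using (+_; -[1+_]; _+_; _-_; _<_; _≤_; +<+; +≤+)
  import Data.Integer.Properties as ℤ
  open import Data.Integer.Tactic.RingSolver using (solve-∀)
  open import Data.Fin using (Fin)
  import Data.Maybe as Maybe
  open import Data.Maybe using (just; nothing)
  open import Data.Sum using (inj₁)
  open import Data.List using (List; []; _∷_; _++_; length; take; drop)
  open import Data.List.Properties using (length-++; length-take; length-drop)
  open import Relation.Binary.PropositionalEquality

  open TM M

  private
    variable
      A : Set

  nth-++ˡ : ∀ (xs ys : List A) {k} → k ℕ.< length xs → nth M (xs ++ ys) k ≡ nth M xs k
  nth-++ˡ (x ∷ xs) ys {zero}  _          = refl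
  nth-++ˡ (x ∷ xs) ys {suc k} (ℕ.s≤s k<) = nth-++ˡ xs ys k<

  nth-++ʳ : ∀ (xs ys : List A) m → nth M (xs ++ ys) (length xs ℕ.+ m) ≡ nth M ys m
  nth-++ʳ []       ys m = refl
  nth-++ʳ (x ∷ xs) ys m = nth-++ʳ xs ys m

  nth-take : ∀ (w : List A) {i k} → k ℕ.< i → nth M (take i w) k ≡ nth M w k
  nth-take []      {zero}          ()
  nth-take []      {suc i}         _           = refl
  nth-take (x ∷ w) {suc i} {zero}  _           = refl
  nth-take (x ∷ w) {suc i} {suc k} (ℕ.s≤s k<i) = nth-take w k<i

  nth-drop : ∀ (w : List A) j m → nth M (drop j w) m ≡ nth M w (j ℕ.+ m)
  nth-drop w       zero    m = refl
  nth-drop []      (suc j) m = refl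
  nth-drop (x ∷ w) (suc j) m = nth-drop w j m

  nth-beyond : ∀ (w : List A) {k} → length w ℕ.≤ k → nth M w k ≡ nothing
  nth-beyond []      _               = refl
  nth-beyond (x ∷ w) (ℕ.s≤s |w|≤k) = nth-beyond w |w|≤k

  initTape-+ : ∀ w k → initTape M w (+ k) ≡ Maybe.map inj₁ (nth M w k)
  initTape-+ w k with nth M w k
  ... | just a  = refl
  ... | nothing = refl

  initTape-blank-left : ∀ w {x} → x < + 0 → initTape M w x ≡ nothing
  initTape-blank-left w { -[1+ k ]} _ = refl
  initTape-blank-left w {+ k} (+<+ ())

  initTape-blank-right : ∀ w {x} → + length w ≤ x → initTape M w x ≡ nothing
  initTape-blank-right w {+ k} (+≤+ |w|≤k) = trans (initTape-+ w k) (cong (Maybe.map inj₁) (nth-beyond w |w|≤k))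

  cut : List (Fin nΣ) → ℕ → ℕ → List (Fin nΣ)
  cut w i j = take i w ++ drop j w

  module _ (w : List (Fin nΣ)) {i j : ℕ} (i≤|w| : i ℕ.≤ length w) where

    private
      length-take-i : length (take i w) ≡ i
      length-take-i = trans (length-take i w) (ℕ.m≤n⇒m⊓n≡m i≤|w|)

    length-cut : length (cut w i j) ≡ i ℕ.+ (length w ∸ j)
    length-cut = trans (length-++ (take i w)) (cong₂ ℕ._+_ length-take-i (length-drop j w))

    initTape-cut-left : ∀ {x} → x < + i → initTape M (cut w i j) x ≡ initTape M w x
    initTape-cut-left { -[1+ k ]} _ = refl
    initTape-cut-left {+ k} (+<+ k<i) = begin
      initTape M (cut w i j) (+ k)             ≡⟨ initTape-+ (cut w i j) k ⟩
      Maybe.map inj₁ (nth M (cut w i j) k)     ≡⟨ cong (Maybe.map inj₁) (nth-++ˡ (take i w) (drop j w) k<|take|) ⟩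
      Maybe.map inj₁ (nth M (take i w) k)      ≡⟨ cong (Maybe.map inj₁) (nth-take w k<i) ⟩
      Maybe.map inj₁ (nth M w k)               ≡⟨ initTape-+ w k ⟨
      initTape M w (+ k)                       ∎
      where
        open ≡-Reasoning
        k<|take| : k ℕ.< length (take i w)
        k<|take| = subst (k ℕ.<_) (sym length-take-i) k<i

    initTape-cut-right : ∀ {x} → + j ≤ x → initTape M (cut w i j) (x + (+ i - + j)) ≡ initTape M w x
    initTape-cut-right {+ k} (+≤+ j≤k) = begin
      initTape M (cut w i j) (+ k + (+ i - + j))            ≡⟨ cong (initTape M (cut w i j)) shifted ⟩
      initTape M (cut w i j) (+ (length (take i w) ℕ.+ m))  ≡⟨ initTape-+ (cut w i j) _ ⟩
      Maybe.map inj₁ (nth M (cut w i j) (length (take i w) ℕ.+ m))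
        ≡⟨ cong (Maybe.map inj₁) (trans (nth-++ʳ (take i w) (drop j w) m) (nth-drop w j m)) ⟩
      Maybe.map inj₁ (nth M w (j ℕ.+ m))
        ≡⟨ cong (λ n → Maybe.map inj₁ (nth M w n)) (ℕ.m+[n∸m]≡n j≤k) ⟩
      Maybe.map inj₁ (nth M w k)                             ≡⟨ initTape-+ w k ⟨
      initTape M w (+ k)                                     ∎
      where
        open ≡-Reasoning
        m = k ∸ j
        shifted : + k + (+ i - + j) ≡ + (length (take i w) ℕ.+ m)
        shifted = begin
          + k + (+ i - + j)                 ≡⟨ cong (λ n → + n + (+ i - + j)) (ℕ.m+[n∸m]≡n j≤k) ⟨
          + (j ℕ.+ m) + (+ i - + j)         ≡⟨ cong (_+ (+ i - + j)) (ℤ.pos-+ j m) ⟩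
          + j + + m + (+ i - + j)           ≡⟨ rearrange (+ i) (+ j) (+ m) ⟩
          + i + + m                         ≡⟨ ℤ.pos-+ i m ⟨
          + (i ℕ.+ m)                       ≡⟨ cong (λ n → + (n ℕ.+ m)) length-take-i ⟨
          + (length (take i w) ℕ.+ m)       ∎
          where
            rearrange : ∀ a b c → b + c + (a - b) ≡ a + c
            rearrange = solve-∀

  length-cut< : ∀ w {i j} → i ℕ.< j → j ℕ.≤ length w → length (cut w i j) ℕ.< length w
  length-cut< w {i} {j} i<j j≤|w| = begin-strict
    length (cut w i j)           ≡⟨ length-cut w {j = j} (ℕ.<⇒≤ (ℕ.<-≤-trans i<j j≤|w|)) ⟩
    i ℕ.+ (length w ∸ j)         <⟨ ℕ.+-monoˡ-< (length w ∸ j) i<j ⟩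
    j ℕ.+ (length w ∸ j)         ≡⟨ ℕ.m+[n∸m]≡n j≤|w| ⟩
    length w                     ∎
    where open ℕ.≤-Reasoning

module Hennie (M : TM) (T : ℕ → ℕ) (runs : RunsInTime M T) (A : ℕ)
  (room : Growth.BelowCrossingBound T (suc (TM.nQ M)) A) where

  open import Data.Nat as ℕ using (ℕ; suc; _∸_; _^_)
  open import Data.Product using (Σ; _×_; _,_; proj₁; proj₂)
  open Integers
  open Lists
  open Machine M
  open InputTape M
  import Data.Nat.Properties as ℕ
  open import Data.Nat.ListAction using (sum)
  open import Data.Nat.ListAction.Properties using (sum-++)
  open import Data.Integer using (ℤ; +_; _+_; _-_; -_; _<_; _≤_; +<+; +≤+; ∣_∣)
  import Data.Integer.Properties as ℤ
  open import Data.Integer.Tactic.RingSolver using (solve-∀)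
  open import Data.Fin using (Fin)
  open import Data.Sum using (_⊎_; inj₁; inj₂)
  open import Data.Empty using (⊥; ⊥-elim)
  open import Data.List using (List; _++_; length; map; applyUpTo; deduplicate)
  open import Data.List.Properties using (length-map; length-applyUpTo; map-applyUpTo; map-++; map-∘; map-cong)
  open import Data.List.Membership.Propositional using (_∈_)
  open import Data.List.Membership.Propositional.Properties using (∈-applyUpTo⁺; ∈-deduplicate⁻)
  open import Data.List.Relation.Binary.Subset.Propositional using (_⊆_)
  open import Data.List.Relation.Unary.Unique.DecPropositional.Properties using (deduplicate-!)
  open import Data.List.Relation.Unary.All as All using (All)
  import Data.List.Relation.Unary.AllPairs.Properties as AllPairs
  open import Data.List.Relation.Unary.Unique.Propositional using (Unique)
  open import Data.List.Extrema ℤ.≤-totalOrder using (xs≤max; ⊥≤max; min≤xs; min≤⊤)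
  open import Relation.Nullary using (¬_; yes; no)
  open import Relation.Binary.PropositionalEquality
  open import Function using (_∘_)

  open TM M

  base : ℕ
  base = suc nQ

  I : List (Fin nΣ) → Config M
  I = initConfig M

  steps≤T : ∀ w {k ps} → Execution (I w) k ps → k ℕ.≤ T (length w)
  steps≤T w E with k , k≤T , halts-after ← runs w =
    subst (ℕ._≤ T (length w)) (sym (proj₁ (Execution-deterministic E (HaltsAfter⇒Execution halts-after)))) k≤T

  DistinctCrossings : ∀ {c k ps} → Execution c k ps → ℤ → ℕ → Set
  DistinctCrossings E a m =
    ∀ {i j} → i ℕ.< j → j ℕ.< m → crossing-sequence E (a + + i) ≢ crossing-sequence E (a + + j)

  block-crossings : ∀ {c k ps} (E : Execution c k ps) (β : ℕ → ℤ) m →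
                    (∀ {i j} → i ℕ.< j → j ℕ.< m → crossing-sequence E (β i) ≢ crossing-sequence E (β j)) →
                    ∀ ℓ → ℓ ℕ.* (m ∸ base ^ ℓ) ℕ.≤ sum (map (λ b → crossings b E) (applyUpTo β m))
  block-crossings E β m distinct ℓ = begin
    ℓ ℕ.* (m ∸ base ^ ℓ)                         ≡⟨ cong (λ n → ℓ ℕ.* (n ∸ base ^ ℓ)) |css|≡m ⟨
    ℓ ℕ.* (length css ∸ base ^ ℓ)                ≤⟨ total-length-of-distinct-words ℓ unique ⟩
    sum (map length css)                         ≡⟨ cong sum lengths ⟩
    sum (map (λ b → crossings b E) (applyUpTo β m)) ∎
    where
      open ℕ.≤-Reasoning
      css = map (crossing-sequence E) (applyUpTo β m)
      |css|≡m : length css ≡ m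
      |css|≡m = trans (length-map _ (applyUpTo β m)) (length-applyUpTo β m)
      unique : Unique css
      unique = subst Unique (sym (map-applyUpTo β (crossing-sequence E) m)) (AllPairs.applyUpTo⁺₁ _ m distinct)
      lengths : map length css ≡ map (λ b → crossings b E) (applyUpTo β m)
      lengths = trans (sym (map-∘ (applyUpTo β m))) (map-cong (length-crossing-sequence E) (applyUpTo β m))

  crossing-budget : ∀ {c k ps} (E : Execution c k ps) a m₁ m₂ → DistinctCrossings E a m₁ →
                    DistinctCrossings E (a + + m₁) m₂ →
                    ∀ ℓ → ℓ ℕ.* (m₁ ∸ base ^ ℓ) ℕ.+ ℓ ℕ.* (m₂ ∸ base ^ ℓ) ℕ.≤ k
  crossing-budget {k = k} E a m₁ m₂ distinct₁ distinct₂ ℓ = begin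
    ℓ ℕ.* (m₁ ∸ base ^ ℓ) ℕ.+ ℓ ℕ.* (m₂ ∸ base ^ ℓ)
      ≤⟨ ℕ.+-mono-≤ (block-crossings E β₁ m₁ distinct₁ ℓ) (block-crossings E β₂ m₂ distinct₂' ℓ) ⟩
    sum (map cr (applyUpTo β₁ m₁)) ℕ.+ sum (map cr (applyUpTo β₂ m₂))
      ≡⟨ sum-++ (map cr (applyUpTo β₁ m₁)) _ ⟨
    sum (map cr (applyUpTo β₁ m₁) ++ map cr (applyUpTo β₂ m₂))
      ≡⟨ cong sum (map-++ cr (applyUpTo β₁ m₁) _) ⟨
    sum (map cr (applyUpTo β₁ m₁ ++ applyUpTo β₂ m₂))
      ≡⟨ cong (sum ∘ map cr) (applyUpTo-+ β₁ m₁ m₂) ⟨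
    sum (map cr (applyUpTo β₁ (m₁ ℕ.+ m₂)))
      ≤⟨ sum-crossings≤steps E (AllPairs.applyUpTo⁺₁ β₁ (m₁ ℕ.+ m₂) (λ i<j _ → ℤ.<⇒≢ (ℤ.+-monoʳ-< a (+<+ i<j))))
      ⟩
    k ∎
    where
      open ℕ.≤-Reasoning
      cr = λ b → crossings b E
      β₁ β₂ : ℕ → ℤ
      β₁ i = a + + i
      β₂ i = a + + (m₁ ℕ.+ i)
      β₂-shift : ∀ i → a + + m₁ + + i ≡ β₂ i
      β₂-shift i = trans (ℤ.+-assoc a (+ m₁) (+ i)) (cong (λ x → a + x) (sym (ℤ.pos-+ m₁ i)))
      distinct₂' : ∀ {i j} → i ℕ.< j → j ℕ.< m₂ → crossing-sequence E (β₂ i) ≢ crossing-sequence E (β₂ j)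
      distinct₂' {i} {j} i<j j<m₂ = subst₂ (λ x y → crossing-sequence E x ≢ crossing-sequence E y)
                                           (β₂-shift i) (β₂-shift j) (distinct₂ i<j j<m₂)

  record Reaches (w : List (Fin nΣ)) (Far : ℤ → Set) : Set where
    field
      steps     : ℕ
      visits    : List ℤ
      execution : Execution (I w) steps visits
      cell      : ℤ
      cell∈     : cell ∈ visits
      far       : Far cell

  FarRight FarLeft : List (Fin nΣ) → Set
  FarRight w = Reaches w (λ x → + (length w ℕ.+ A) ≤ x)
  FarLeft  w = Reaches w (_≤ - + A)

  cut-word : ∀ w {k ps} (E : Execution (I w) k ps) {i j} → i ℕ.< j → j ℕ.< length w →
             crossing-sequence E (+ suc i) ≡ crossing-sequence E (+ suc j) →
             Cut (_< + suc i) (+ suc j ≤_) (+ suc i - + suc j) ps (I (cut w (suc i) (suc j)))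
  cut-word w E i<j j<n same = cut-right E (+<+ (ℕ.s≤s ℕ.z≤n)) (+<+ (ℕ.s≤s i<j)) same
    (agreement refl refl (λ x → initTape-cut-left w {j = suc _} 1+i≤n))
    (λ x → initTape-cut-right w 1+i≤n)
    where 1+i≤n = ℕ.<⇒≤ (ℕ.<-≤-trans (ℕ.s≤s i<j) j<n)

  module _ (w : List (Fin nΣ)) {k ps} (E : Execution (I w) k ps) where

    private
      n = length w

    within-time : (∀ ℓ → ℓ ℕ.* (n ∸ base ^ ℓ) ℕ.+ ℓ ℕ.* (A ∸ base ^ ℓ) ℕ.≤ k) → ⊥
    within-time crossings≤k = ℕ.<-irrefl refl (begin-strict
      T n                                             <⟨ proj₂ (room n) ⟩
      ℓ ℕ.* (n ∸ base ^ ℓ) ℕ.+ ℓ ℕ.* (A ∸ base ^ ℓ)    ≤⟨ crossings≤k ℓ ⟩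
      k                                               ≤⟨ steps≤T w E ⟩
      T n                                             ∎)
      where
        open ℕ.≤-Reasoning
        ℓ = proj₁ (room n)

    -- Cutting blank tape between equal crossing sequences leaves w and hence the run unchanged,
    -- yet it would move the extreme visited cell.
    blank-right-distinct : ∀ {X} → X ∈ ps → All (_≤ X) ps → + (n ℕ.+ A) ≤ X →
                           DistinctCrossings E (+ 1 + + n) A
    blank-right-distinct {X} X∈ps ps≤X n+A≤X {i} {j} i<j j<A same =
      X-unmoved (visits⊆ (subst (X ∈_) (sym visits≡ps) X∈ps))
      where
        b₁ b₂ off : ℤ
        b₁ = + (suc n ℕ.+ i)
        b₂ = + (suc n ℕ.+ j)
        off = b₁ - b₂
        b₁<b₂ : b₁ < b₂
        b₁<b₂ = +<+ (ℕ.+-monoʳ-< (suc n) i<j)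
        n≤b₁ : + n ≤ b₁
        n≤b₁ = +≤+ (ℕ.≤-trans (ℕ.n≤1+n n) (ℕ.m≤m+n (suc n) i))
        b₁≤n+A : b₁ ≤ + (n ℕ.+ A)
        b₁≤n+A = +≤+ (subst (ℕ._≤ n ℕ.+ A) (ℕ.+-suc n i) (ℕ.+-monoʳ-≤ n (ℕ.<-trans i<j j<A)))
        blank-shift : ∀ x → b₂ ≤ x → initTape M w (x + off) ≡ initTape M w x
        blank-shift x b₂≤x = trans
          (initTape-blank-right w (ℤ.≤-trans n≤b₁ (subst (_≤ x + off) (j+[i-j]≡i b₁ b₂) (ℤ.+-monoˡ-≤ off b₂≤x))))
          (sym (initTape-blank-right w (ℤ.≤-trans n≤b₁ (ℤ.≤-trans (ℤ.<⇒≤ b₁<b₂) b₂≤x))))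
        open Cut (cut-right E (+<+ (ℕ.s≤s ℕ.z≤n)) b₁<b₂ same (agreement refl refl (λ _ _ → refl)) blank-shift)
        visits≡ps = proj₂ (Execution-deterministic execution E)
        X-unmoved : X < b₁ ⊎ Σ ℤ (λ y → y ∈ ps × X ≡ y + off) → ⊥
        X-unmoved (inj₁ X<b₁) = ℤ.<-irrefl refl (ℤ.<-≤-trans X<b₁ (ℤ.≤-trans b₁≤n+A n+A≤X))
        X-unmoved (inj₂ (y , y∈ps , X≡y+off)) = ℤ.<-irrefl refl
          (ℤ.<-≤-trans (subst (_< y) (sym X≡y+off) (i+k<i y (i<j⇒i-j<0 b₁<b₂))) (All.lookup ps≤X y∈ps))

    blank-left-distinct : ∀ {Y} → Y ∈ ps → All (Y ≤_) ps → Y ≤ - + A → DistinctCrossings E (+ 1 - + A) A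
    blank-left-distinct {Y} Y∈ps Y≤ps Y≤-A {i} {j} i<j j<A same =
      Y-unmoved (visits⊆ (subst (Y ∈_) (sym visits≡ps) Y∈ps))
      where
        b₁ b₂ off : ℤ
        b₁ = + 1 - + A + + i
        b₂ = + 1 - + A + + j
        off = b₂ - b₁
        b₁<b₂ : b₁ < b₂
        b₁<b₂ = ℤ.+-monoʳ-< (+ 1 - + A) (+<+ i<j)
        b₂≤0 : b₂ ≤ + 0
        b₂≤0 = subst (_≤ + 0) (rearrange (+ A) (+ j)) (ℤ.i≤j⇒i-j≤0 (+≤+ j<A))
          where
            rearrange : ∀ A j → + 1 + j - A ≡ + 1 - A + j
            rearrange = solve-∀
        -A<b₂ : - + A < b₂
        -A<b₂ = ℤ.<-≤-trans (subst (- + A <_) (ℤ.+-comm (- + A) (+ 1)) (i<i+1 (- + A))) (ℤ.i≤i+j _ (+ j))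
        blank-shift : ∀ x → x < b₁ → initTape M w (x + off) ≡ initTape M w x
        blank-shift x x<b₁ = trans
          (initTape-blank-left w (ℤ.<-≤-trans (subst (x + off <_) (j+[i-j]≡i b₂ b₁) (ℤ.+-monoˡ-< off x<b₁)) b₂≤0))
          (sym (initTape-blank-left w (ℤ.<-≤-trans (ℤ.<-trans x<b₁ b₁<b₂) b₂≤0)))
        open Cut (cut-left E b₁<b₂ b₂≤0 same (agreement refl refl (λ _ _ → refl)) blank-shift)
        visits≡ps = proj₂ (Execution-deterministic execution E)
        Y-unmoved : b₂ ≤ Y ⊎ Σ ℤ (λ y → y ∈ ps × Y ≡ y + off) → ⊥
        Y-unmoved (inj₁ b₂≤Y) = ℤ.<-irrefl refl (ℤ.<-≤-trans (ℤ.≤-<-trans Y≤-A -A<b₂) b₂≤Y)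
        Y-unmoved (inj₂ (y , y∈ps , Y≡y+off)) = ℤ.<-irrefl refl
          (ℤ.≤-<-trans (All.lookup Y≤ps y∈ps) (subst (y <_) (sym Y≡y+off) (i<i+k y (i<j⇒0<j-i b₁<b₂))))

  private
    cut-far : ∀ i j n a → j ℕ.≤ n → + (i ℕ.+ (n ∸ j) ℕ.+ a) ≡ + (n ℕ.+ a) + (+ i - + j)
    cut-far i j n a j≤n = begin
      + (i ℕ.+ r ℕ.+ a)                 ≡⟨ pos-+₃ i r a ⟩
      + i + + r + + a                   ≡⟨ rearrange (+ i) (+ j) (+ r) (+ a) ⟩
      + j + + r + + a + (+ i - + j)     ≡⟨ cong (_+ (+ i - + j)) (pos-+₃ j r a) ⟨
      + (j ℕ.+ r ℕ.+ a) + (+ i - + j)   ≡⟨ cong (λ m → + (m ℕ.+ a) + (+ i - + j)) (ℕ.m+[n∸m]≡n j≤n) ⟩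
      + (n ℕ.+ a) + (+ i - + j)         ∎
      where
        open ≡-Reasoning
        r = n ∸ j
        pos-+₃ : ∀ x y z → + (x ℕ.+ y ℕ.+ z) ≡ + x + + y + + z
        pos-+₃ x y z = trans (ℤ.pos-+ (x ℕ.+ y) z) (cong (_+ + z) (ℤ.pos-+ x y))
        rearrange : ∀ i j r a → i + r + a ≡ j + r + a + (i - j)
        rearrange = solve-∀

  -- Cutting w between equal crossing sequences gives a shorter input that still reaches as far.
  word-right-distinct : ∀ w → (∀ {w'} → length w' ℕ.< length w → ¬ FarRight w') →
                        (far-run : FarRight w) → DistinctCrossings (Reaches.execution far-run) (+ 1) (length w)
  word-right-distinct w shorter far-run {i} {j} i<j j<n same = shorter (length-cut< w (ℕ.s≤s i<j) j<n) (record
    { execution = execution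
    ; cell∈ = moved cell∈ (ℤ.≤-trans (+≤+ (ℕ.≤-trans j<n (ℕ.m≤m+n (length w) A))) far)
    ; far = subst (_≤ cell + (+ suc i - + suc j))
                  (trans (sym (cut-far (suc i) (suc j) (length w) A j<n))
                         (cong (λ m → + (m ℕ.+ A)) (sym (length-cut w {j = suc j} 1+i≤n))))
                  (ℤ.+-monoˡ-≤ (+ suc i - + suc j) far) })
    where
      open Reaches far-run using (cell; cell∈; far)
      open Cut (cut-word w (Reaches.execution far-run) i<j j<n same)
      1+i≤n = ℕ.<⇒≤ (ℕ.<-≤-trans (ℕ.s≤s i<j) j<n)

  word-left-distinct : ∀ w → (∀ {w'} → length w' ℕ.< length w → ¬ FarLeft w') →
                       (far-run : FarLeft w) → DistinctCrossings (Reaches.execution far-run) (+ 1) (length w)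
  word-left-distinct w shorter far-run {i} {j} i<j j<n same = shorter (length-cut< w (ℕ.s≤s i<j) j<n) (record
    { execution = execution
    ; cell∈ = kept cell∈ (ℤ.≤-<-trans far (ℤ.≤-<-trans ℤ.neg-≤-pos (+<+ (ℕ.s≤s ℕ.z≤n))))
    ; far = far })
    where
      open Reaches far-run using (cell; cell∈; far)
      open Cut (cut-word w (Reaches.execution far-run) i<j j<n same)

  no-far-right : ∀ w → ¬ FarRight w
  no-far-right = length-rec (λ w → ¬ FarRight w) λ w shorter far-run →
    let open Reaches far-run in
    within-time w execution (crossing-budget execution (+ 1) (length w) A
      (word-right-distinct w shorter far-run)
      (blank-right-distinct w execution (max-∈ cell∈) (xs≤max cell visits) (ℤ.≤-trans far (⊥≤max cell visits))))

  no-far-left : ∀ w → ¬ FarLeft w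
  no-far-left = length-rec (λ w → ¬ FarLeft w) λ w shorter far-run →
    let open Reaches far-run
        n = length w
    in
    within-time w execution (λ ℓ → subst (ℕ._≤ steps) (ℕ.+-comm (ℓ ℕ.* (A ∸ base ^ ℓ)) (ℓ ℕ.* (n ∸ base ^ ℓ)))
      (crossing-budget execution (+ 1 - + A) A n
        (blank-left-distinct w execution (min-∈ cell∈) (min≤xs cell visits) (ℤ.≤-trans (min≤⊤ cell visits) far))
        (subst (λ a → DistinctCrossings execution a n) (sym (i-j+j≡i (+ 1) (+ A))) (word-left-distinct w shorter far-run))
        ℓ))

  visits-within : ∀ w {k ps} → Execution (I w) k ps → ∀ {y} → y ∈ ps → - + A < y × y < + (length w ℕ.+ A)
  visits-within w E {y} y∈ps with y ℤ.≤? - + A | + (length w ℕ.+ A) ℤ.≤? y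
  ... | yes y≤-A | _        = ⊥-elim (no-far-left w (record { execution = E ; cell∈ = y∈ps ; far = y≤-A }))
  ... | no  _    | yes far  = ⊥-elim (no-far-right w (record { execution = E ; cell∈ = y∈ps ; far = far }))
  ... | no  y≰-A | no  y≱   = ℤ.≰⇒> y≰-A , ℤ.≰⇒> y≱

  visitedCells≤ : ∀ w t → visitedCells M w t ℕ.≤ length w ℕ.+ (A ℕ.+ A)
  visitedCells≤ w t with k , _ , halts-after ← runs w = begin
    length cells              ≤⟨ Unique-⊆⇒length≤ (deduplicate-! ℤ._≟_ (trace M t (I w))) cells⊆window ⟩
    length window             ≡⟨ length-applyUpTo _ (n ℕ.+ A ℕ.+ A) ⟩
    n ℕ.+ A ℕ.+ A             ≡⟨ ℕ.+-assoc n A A ⟩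
    n ℕ.+ (A ℕ.+ A)           ∎
    where
      open ℕ.≤-Reasoning
      n = length w
      E = HaltsAfter⇒Execution {k = k} halts-after
      cells = deduplicate ℤ._≟_ (trace M t (I w))
      window = applyUpTo (λ i → - + A + + i) (n ℕ.+ A ℕ.+ A)
      in-window : ∀ {y} → - + A < y × y < + (n ℕ.+ A) → y ∈ window
      in-window {y} (-A<y , y<n+A) = subst (_∈ window) -A+i≡y (∈-applyUpTo⁺ _ i<)
        where
          0≤y+A : + 0 ≤ y + + A
          0≤y+A = ℤ.<⇒≤ (subst (_< y + + A) (ℤ.+-inverseˡ (+ A)) (ℤ.+-monoˡ-< (+ A) -A<y))
          i = ∣ y + + A ∣
          +i≡y+A : + i ≡ y + + A
          +i≡y+A = ℤ.0≤i⇒+∣i∣≡i 0≤y+A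
          -A+i≡y : - + A + + i ≡ y
          -A+i≡y = trans (cong (λ z → - + A + z) +i≡y+A) (cancel (+ A) y)
            where
              cancel : ∀ a y → - a + (y + a) ≡ y
              cancel = solve-∀
          i< : i ℕ.< n ℕ.+ A ℕ.+ A
          i< = ℤ.drop‿+<+ (subst (_< + (n ℕ.+ A ℕ.+ A)) (sym +i≡y+A) (ℤ.+-monoˡ-< (+ A) y<n+A))
      cells⊆window : cells ⊆ window
      cells⊆window y∈ = in-window (visits-within w E (trace⊆visits E t (∈-deduplicate⁻ ℤ._≟_ _ y∈)))

open import Data.Nat using (_+_; _≤_)
open import Data.List using (List; length)
open import Data.Fin using (Fin)
open import Data.Product using (∃; _,_)

corollary4p11 : (M : TM) (T : ℕ → ℕ) → LittleONLogN T → RunsInTime M T →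
    ∃ λ (D : ℕ) → ∀ (w : List (Fin (TM.nΣ M))) (t : ℕ) → visitedCells M w t ≤ length w + D
corollary4p11 M T o[n·log₂n] runs with A , room ← Growth.LittleONLogN⇒BelowCrossingBound o[n·log₂n] (suc (TM.nQ M)) =
  A + A , Hennie.visitedCells≤ M T runs A room
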